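{- Let $P$ and $Q$ be posets with ground sets $\{1,\dots,n_1\}$ and $\{n_1+1,\dots,n_1+n_2\}$, and $n=n_1+n_2$. Then $\mathrm{QLB}(P+Q)=\mathrm{QLB}(P)+\mathrm{QLB}(Q)+nH_n-n_1H_{n_1}-n_2H_{n_2}$.
   Context: For a poset $R$ on an $m$-element ground set $A$: a linear extension is a bijection $\sigma:A\to[m]$ with $i\le_R j\implies\sigma(i)\le\sigma(j)$; $\Delta(R)$ is the set of linear extensions. For $y\in\mathbb{R}^A$ with $i\le_R j\implies y_i\le y_j$, $d_i(y)=y_i$ if $i$ is minimal in $R$, and otherwise $d_i(y)=\min\{y_i-y_j: j\ne i,\ j\le_R i\}$; for $\sigma\in\Delta(R)$, $d_i(\sigma):=d_i((\sigma(a))_{a\in A})$. $H_q=\sum_{k=1}^q1/k$, $H_0=0$. $\mathrm{QLB}(R)=\mathbb{E}_\sigma\left[\sum_{i\in A}H_{d_i(\sigma)-1}\right]$ with $\sigma$ uniform on $\Delta(R)$. The parallel composition $P+Q$ is the poset on the union of the ground sets with $x\le y$ iff $x\le_P y$ or $x\le_Q y$. -}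

module Defs where

open import Data.Nat using (ℕ; zero; suc; _∸_; _⊓_)
open import Data.Integer using (+_)
open import Data.Rational using (ℚ; 0ℚ; _+_; _*_; _/_)
open import Data.Fin using (Fin; zero; suc; toℕ; splitAt; _≟_)
open import Data.Fin.Properties using () renaming (_≤?_ to _≤F?_)
open import Data.Fin using () renaming (_≤_ to _≤F_)
open import Data.List using (List; []; _∷_; [_]; map; concatMap; filter; foldr; length; allFin)
open import Data.Bool.ListAction using (all; any)
open import Level using (0ℓ)
open import Data.Bool using (Bool; true; false; _∧_; not; if_then_else_)
open import Data.Sum using (_⊎_; inj₁; inj₂)
open import Data.Empty using (⊥)
open import Relation.Nullary using (Dec; yes; no; does)
open import Relation.Unary using () renaming (Decidable to DecPred)
open import Relation.Binary using (Rel; Decidable)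

-- A (decidable) binary relation on the ground set Fin m = {0,…,m-1}
-- (standing for {1,…,m}).

H : ℕ → ℚ
H zero    = 0ℚ
H (suc q) = H q + (+ 1 / suc q)

allFuns : (m k : ℕ) → List (Fin m → Fin k)
allFuns zero    k = [ (λ ()) ]
allFuns (suc m) k =
  concatMap (λ v → map (λ f → λ { zero → v ; (suc i) → f i }) (allFuns m k)) (allFin k)

module _ {m : ℕ} (R : Rel (Fin m) 0ℓ) (R? : Decidable R) where

  isBijection : (Fin m → Fin m) → Bool
  isBijection σ =
    all (λ i → all (λ j → not (does (σ i ≟ σ j)) Data.Bool.∨ does (i ≟ j)) (allFin m)) (allFin m)
    ∧ all (λ k → any (λ i → does (σ i ≟ k)) (allFin m)) (allFin m)

  isMonotone : (Fin m → Fin m) → Bool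
  isMonotone σ =
    all (λ i → all (λ j → not (does (R? i j)) Data.Bool.∨ does (σ i ≤F? σ j)) (allFin m)) (allFin m)

  Δ : List (Fin m → Fin m)
  Δ = filter (λ σ → isBijection σ ∧ isMonotone σ Data.Bool.≟ true) (allFuns m m)

  -- values of σ taken in [m] = {1,…,m}
  val : (Fin m → Fin m) → Fin m → ℕ
  val σ a = suc (toℕ (σ a))

  preds : Fin m → List (Fin m)
  preds i = filter (λ j → not (does (j ≟ i)) ∧ does (R? j i) Data.Bool.≟ true) (allFin m)

  d : (Fin m → Fin m) → Fin m → ℕ
  d σ i with map (λ j → val σ i ∸ val σ j) (preds i)
  ... | []     = val σ i
  ... | x ∷ xs = foldr _⊓_ x xs

  sumℚ : List ℚ → ℚ
  sumℚ = foldr _+_ 0ℚ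

  qlbTerm : (Fin m → Fin m) → ℚ
  qlbTerm σ = sumℚ (map (λ i → H (d σ i ∸ 1)) (allFin m))

  -- average of a sum over a list of given length (0 for the empty list,
  -- which never occurs since Δ(R) ≠ ∅ for a poset)
  average : ℚ → ℕ → ℚ
  average s zero    = 0ℚ
  average s (suc k) = s * (+ 1 / suc k)

  QLB : ℚ
  QLB = average (sumℚ (map qlbTerm Δ)) (length Δ)

-- Parallel composition: P on {0..n₁-1}, Q on {n₁..n₁+n₂-1} (via splitAt).
data SumRel {n₁ n₂ : ℕ} (P : Rel (Fin n₁) 0ℓ) (Q : Rel (Fin n₂) 0ℓ)
     : Fin n₁ ⊎ Fin n₂ → Fin n₁ ⊎ Fin n₂ → Set where
  left  : ∀ {a b} → P a b → SumRel P Q (inj₁ a) (inj₁ b)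
  right : ∀ {a b} → Q a b → SumRel P Q (inj₂ a) (inj₂ b)

_⊕_ : ∀ {n₁ n₂} → Rel (Fin n₁) 0ℓ → Rel (Fin n₂) 0ℓ → Rel (Fin (n₁ Data.Nat.+ n₂)) 0ℓ
_⊕_ {n₁} P Q x y = SumRel P Q (splitAt n₁ x) (splitAt n₁ y)

⊕-dec : ∀ {n₁ n₂} {P : Rel (Fin n₁) 0ℓ} {Q : Rel (Fin n₂) 0ℓ} →
        Decidable P → Decidable Q → Decidable (P ⊕ Q)
⊕-dec {n₁} {P = P} {Q} P? Q? x y = go (splitAt n₁ x) (splitAt n₁ y)
  where
  go : (u v : Fin _ ⊎ Fin _) → Dec (SumRel P Q u v)
  go (inj₁ a) (inj₁ b) with P? a b
  ... | yes p = yes (left p)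
  ... | no ¬p = no λ { (left p) → ¬p p }
  go (inj₂ a) (inj₂ b) with Q? a b
  ... | yes q = yes (right q)
  ... | no ¬q = no λ { (right q) → ¬q q }
  go (inj₁ a) (inj₂ b) = no λ ()
  go (inj₂ a) (inj₁ b) = no λ ()

nH : ℕ → ℚ
nH n = (+ n / 1) * H n

module Submission where

-- A linear extension of P ⊕ Q is the same as a triple (p, q, s) of linear
-- extensions p of P and q of Q and a colour word s of length n = n₁ + n₂ with n₁
-- letters c₁, recording which positions hold elements of P (module Merge). Under
-- this bijection an element of P at position v of p, with d-value δ there, moves
-- to the v-th letter c₁ of s, and its d-value becomes the gap between the
-- (v-δ)-th and v-th letters c₁ (Merge.Merged.d-inL). The analytic core (GapSums)
-- is that H(gap - 1), averaged over the C(n, n₁) words, is H_{δ-1} + H_n - H_{n₁};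
-- it is proved by induction on n using Pascal's rule. Summing over each block
-- (BlockSums) and over all triples (Reindexing: sums over Δ(P ⊕ Q) are reindexed
-- by inserting point masses) gives
--   |Δ(P ⊕ Q)| QLB(P ⊕ Q) = C(n,n₁) |Δ(P)| |Δ(Q)| (QLB(P) + QLB(Q) + n₁(H_n - H_{n₁}) + n₂(H_n - H_{n₂}))
-- with |Δ(P ⊕ Q)| = C(n,n₁) |Δ(P)| |Δ(Q)| > 0, whence the theorem (ParallelComposition).

open import Data.Nat using (ℕ)
open import Data.Fin using (Fin)
open import Relation.Binary using (Rel; Decidable; IsPartialOrder)
open import Relation.Binary.PropositionalEquality using (_≡_)
open import Level using (0ℓ)

module RationalArithmetic where

  open import Data.Nat as ℕ using (ℕ; zero; suc)
  import Data.Nat.Coprimality as Coprime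
  import Data.Integer as ℤ
  import Data.Integer.Properties as ℤP
  open import Data.Rational using (ℚ; 0ℚ; 1ℚ; _+_; _*_; _/_; mkℚ)
  import Data.Rational.Properties as ℚP
  open import Relation.Binary.PropositionalEquality
  open import Data.Rational.Solver
  open +-*-Solver

  -- The embedding ℕ → ℚ, by recursion so that it is additive by computation.
  ι : ℕ → ℚ
  ι zero    = 0ℚ
  ι (suc n) = 1ℚ + ι n

  ι-+ : (a b : ℕ) → ι (a ℕ.+ b) ≡ ι a + ι b
  ι-+ zero    b = sym (ℚP.+-identityˡ (ι b))
  ι-+ (suc a) b = trans (cong (1ℚ +_) (ι-+ a b)) (sym (ℚP.+-assoc 1ℚ (ι a) (ι b)))

  ι-* : (a b : ℕ) → ι (a ℕ.* b) ≡ ι a * ι b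
  ι-* zero    b = sym (ℚP.*-zeroˡ (ι b))
  ι-* (suc a) b = trans (ι-+ b (a ℕ.* b)) (trans (cong (ι b +_) (ι-* a b))
    (solve 2 (λ x y → y :+ x :* y := (con 1ℚ :+ x) :* y) refl (ι a) (ι b)))

  -- ι agrees with the library's normal form of n / 1; hence it is injective and
  -- ι (suc q) is invertible.
  ι-mkℚ : ∀ m → ι m ≡ mkℚ (ℤ.+ m) 0 (Coprime.sym (Coprime.1-coprimeTo m))
  ι-mkℚ zero    = refl
  ι-mkℚ (suc m) = trans (cong (1ℚ +_) (ι-mkℚ m))
    (trans (ℚP./-cong {p₂ = ℤ.+ suc m} {q₂ = 1} (cong (λ z → ℤ.+ 1 ℤ.+ z) (ℤP.*-identityʳ (ℤ.+ m))) refl)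
           (ℚP.normalize-coprime (Coprime.sym (Coprime.1-coprimeTo (suc m)))))

  ι-/1 : ∀ m → ι m ≡ ℤ.+ m / 1
  ι-/1 m = trans (ι-mkℚ m) (sym (ℚP.normalize-coprime (Coprime.sym (Coprime.1-coprimeTo m))))

  ι-injective : ∀ a b → ι a ≡ ι b → a ≡ b
  ι-injective a b e = ℤP.+-injective (cong ℚ.numerator (trans (sym (ι-mkℚ a)) (trans e (ι-mkℚ b))))

  inv : ℕ → ℚ
  inv q = ℤ.+ 1 / suc q

  inv-ι : ∀ q → inv q * ι (suc q) ≡ 1ℚ
  inv-ι q = trans (cong₂ _*_ (ℚP.normalize-coprime (Coprime.1-coprimeTo (suc q))) (ι-mkℚ (suc q)))
                  (ℚP.*-inverseˡ (mkℚ (ℤ.+ suc q) 0 (Coprime.sym (Coprime.1-coprimeTo (suc q)))))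

  *inv*ι : ∀ x k → x * inv k * ι (suc k) ≡ x
  *inv*ι x k = trans (ℚP.*-assoc x (inv k) (ι (suc k))) (trans (cong (x *_) (inv-ι k)) (ℚP.*-identityʳ x))

  *ι*inv : ∀ x k → x * ι (suc k) * inv k ≡ x
  *ι*inv x k = trans (solve 3 (λ x n i → x :* n :* i := x :* i :* n) refl x (ι (suc k)) (inv k)) (*inv*ι x k)

  *ι-cancelʳ : ∀ x y m → 1 ℕ.≤ m → x * ι m ≡ y * ι m → x ≡ y
  *ι-cancelʳ x y (suc k) _ e = trans (sym (*ι*inv x k)) (trans (cong (_* inv k) e) (*ι*inv y k))

module BooleanTests where

  open import Data.Nat as ℕ using (ℕ; zero; suc)
  open import Data.Fin using (Fin; zero; suc; _↑ˡ_; _↑ʳ_)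
  open import Data.List using (List; []; _∷_; map; filter; _++_; tabulate; allFin)
  import Data.List.Properties as ListP
  open import Data.Bool using (Bool; true; false; _∧_; _∨_; not)
  import Data.Bool as Bool
  open import Data.Bool.ListAction using (all; any)
  open import Data.Product using (Σ; _,_)
  open import Relation.Nullary using (Dec; yes; no; does; ¬_)
  open import Relation.Binary.PropositionalEquality

  ∧-true⁻ˡ : ∀ {a b} → a ∧ b ≡ true → a ≡ true
  ∧-true⁻ˡ {true} _ = refl

  ∧-true⁻ʳ : ∀ {a b} → a ∧ b ≡ true → b ≡ true
  ∧-true⁻ʳ {true} e = e

  ∧-true⁺ : ∀ {a b} → a ≡ true → b ≡ true → a ∧ b ≡ true
  ∧-true⁺ refl refl = refl

  bool-ext : (a b : Bool) → (a ≡ true → b ≡ true) → (b ≡ true → a ≡ true) → a ≡ b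
  bool-ext true  true  _ _ = refl
  bool-ext true  false f _ = sym (f refl)
  bool-ext false true  _ g = g refl
  bool-ext false false _ _ = refl

  true≢false : true ≢ false
  true≢false ()

  from-does : {P : Set} (d : Dec P) → does d ≡ true → P
  from-does (yes p) _ = p

  from-not-does : {P : Set} (d : Dec P) → not (does d) ≡ true → ¬ P
  from-not-does (no ¬p) _ = ¬p

  all-allFin⁻ : (m : ℕ) (p : Fin m → Bool) → all p (allFin m) ≡ true → ∀ i → p i ≡ true
  all-allFin⁻ m p = go m (λ i → i)
    where
    go : (k : ℕ) (g : Fin k → Fin m) → all p (tabulate g) ≡ true → ∀ i → p (g i) ≡ true
    go (suc k) g e zero    = ∧-true⁻ˡ e
    go (suc k) g e (suc i) = go k (λ j → g (suc j)) (∧-true⁻ʳ {p (g zero)} e) i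

  all-allFin⁺ : (m : ℕ) (p : Fin m → Bool) → (∀ i → p i ≡ true) → all p (allFin m) ≡ true
  all-allFin⁺ m p = go m (λ i → i)
    where
    go : (k : ℕ) (g : Fin k → Fin m) → (∀ i → p (g i) ≡ true) → all p (tabulate g) ≡ true
    go zero    g h = refl
    go (suc k) g h = ∧-true⁺ (h zero) (go k (λ j → g (suc j)) (λ i → h (suc i)))

  any-allFin⁻ : (m : ℕ) (p : Fin m → Bool) → any p (allFin m) ≡ true → Σ (Fin m) (λ i → p i ≡ true)
  any-allFin⁻ m p = go m (λ i → i)
    where
    go : (k : ℕ) (g : Fin k → Fin m) → any p (tabulate g) ≡ true → Σ (Fin k) (λ i → p (g i) ≡ true)
    go (suc k) g e with p (g zero) in eq
    ... | true  = zero , eq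
    ... | false = let (i , h) = go k (λ j → g (suc j)) e in suc i , h

  any-allFin⁺ : (m : ℕ) (p : Fin m → Bool) (i : Fin m) → p i ≡ true → any p (allFin m) ≡ true
  any-allFin⁺ m p = go m (λ i → i)
    where
    go : (k : ℕ) (g : Fin k → Fin m) (i : Fin k) → p (g i) ≡ true → any p (tabulate g) ≡ true
    go (suc k) g zero    h rewrite h = refl
    go (suc k) g (suc i) h with p (g zero)
    ... | true  = refl
    ... | false = go k (λ j → g (suc j)) i h

  any-cong : {A : Set} (p q : A → Bool) (L : List A) → (∀ x → p x ≡ q x) → any p L ≡ any q L
  any-cong p q []      h = refl
  any-cong p q (x ∷ L) h = cong₂ _∨_ (h x) (any-cong p q L h)

  any-allFin-false : (m : ℕ) (p : Fin m → Bool) → (∀ i → p i ≡ false) → any p (allFin m) ≡ false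
  any-allFin-false m p h with any p (allFin m) in e
  ... | false = refl
  ... | true  = let (i , pᵢ) = any-allFin⁻ m p e in trans (sym pᵢ) (h i)

  filterᵇ : {A : Set} → (A → Bool) → List A → List A
  filterᵇ b = filter (λ x → b x Bool.≟ true)

  filterᵇ-map : {A B : Set} (b : B → Bool) (f : A → B) (L : List A) → filterᵇ b (map f L) ≡ map f (filterᵇ (λ x → b (f x)) L)
  filterᵇ-map b f []      = refl
  filterᵇ-map b f (x ∷ L) with b (f x)
  ... | true  = cong (f x ∷_) (filterᵇ-map b f L)
  ... | false = filterᵇ-map b f L

  filterᵇ-cong : {A : Set} {b b' : A → Bool} → (∀ x → b x ≡ b' x) → (L : List A) → filterᵇ b L ≡ filterᵇ b' L
  filterᵇ-cong eq []      = refl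
  filterᵇ-cong {b = b} {b'} eq (x ∷ L) with b x | b' x | eq x
  ... | true  | true  | _ = cong (x ∷_) (filterᵇ-cong eq L)
  ... | false | false | _ = filterᵇ-cong eq L

  filterᵇ-false : {A : Set} (L : List A) → filterᵇ (λ _ → false) L ≡ []
  filterᵇ-false []      = refl
  filterᵇ-false (x ∷ L) = filterᵇ-false L

  allFin-+ : (a b : ℕ) → allFin (a ℕ.+ b) ≡ map (_↑ˡ b) (allFin a) ++ map (a ↑ʳ_) (allFin b)
  allFin-+ a b = trans (tabulate-+ a (λ i → i))
    (sym (cong₂ _++_ (ListP.map-tabulate (λ i → i) (_↑ˡ b)) (ListP.map-tabulate (λ i → i) (a ↑ʳ_))))
    where
    tabulate-+ : {A : Set} (a : ℕ) (f : Fin (a ℕ.+ b) → A) → tabulate f ≡ tabulate (λ i → f (i ↑ˡ b)) ++ tabulate (λ j → f (a ↑ʳ j))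
    tabulate-+ zero    f = refl
    tabulate-+ (suc a) f = cong (f zero ∷_) (tabulate-+ a (λ i → f (suc i)))

module FiniteSums where

  open RationalArithmetic
  open BooleanTests using (filterᵇ)
  open import Data.Nat as ℕ using (ℕ; zero; suc)
  open import Data.Rational using (ℚ; 0ℚ; 1ℚ; _+_; _*_)
  import Data.Rational.Properties as ℚP
  open import Data.Fin using (Fin; zero; suc; _≟_)
  open import Data.List using (List; []; _∷_; map; foldr; concatMap; filter; _++_; tabulate; allFin; length)
  import Data.List.Properties as ListP
  open import Data.Bool using (Bool; true; false; if_then_else_; _∧_)
  import Data.Bool as Bool
  open import Relation.Nullary using (does)
  open import Relation.Binary.PropositionalEquality
  open import Data.Rational.Solver
  open +-*-Solver

  ∑ : {A : Set} → List A → (A → ℚ) → ℚ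
  ∑ L f = foldr _+_ 0ℚ (map f L)

  ∑-cong : {A : Set} (L : List A) {f g : A → ℚ} → (∀ x → f x ≡ g x) → ∑ L f ≡ ∑ L g
  ∑-cong []      eq = refl
  ∑-cong (x ∷ L) eq = cong₂ _+_ (eq x) (∑-cong L eq)

  ∑-zero : {A : Set} (L : List A) → ∑ L (λ _ → 0ℚ) ≡ 0ℚ
  ∑-zero []      = refl
  ∑-zero (x ∷ L) = cong (0ℚ +_) (∑-zero L)

  ∑-+ : {A : Set} (L : List A) (f g : A → ℚ) → ∑ L (λ x → f x + g x) ≡ ∑ L f + ∑ L g
  ∑-+ []      f g = sym (ℚP.+-identityˡ 0ℚ)
  ∑-+ (x ∷ L) f g = trans (cong ((f x + g x) +_) (∑-+ L f g))
    (solve 4 (λ a b c e → (a :+ b) :+ (c :+ e) := (a :+ c) :+ (b :+ e)) refl (f x) (g x) (∑ L f) (∑ L g))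

  ∑-*ˡ : {A : Set} (L : List A) (c : ℚ) (f : A → ℚ) → ∑ L (λ x → c * f x) ≡ c * ∑ L f
  ∑-*ˡ []      c f = sym (ℚP.*-zeroʳ c)
  ∑-*ˡ (x ∷ L) c f = trans (cong (c * f x +_) (∑-*ˡ L c f)) (sym (ℚP.*-distribˡ-+ c (f x) (∑ L f)))

  ∑-*ʳ : {A : Set} (L : List A) (c : ℚ) (f : A → ℚ) → ∑ L (λ x → f x * c) ≡ ∑ L f * c
  ∑-*ʳ L c f = trans (∑-cong L (λ x → ℚP.*-comm (f x) c)) (trans (∑-*ˡ L c f) (ℚP.*-comm c (∑ L f)))

  ∑-++ : {A : Set} (L M : List A) (f : A → ℚ) → ∑ (L ++ M) f ≡ ∑ L f + ∑ M f
  ∑-++ []      M f = sym (ℚP.+-identityˡ (∑ M f))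
  ∑-++ (x ∷ L) M f = trans (cong (f x +_) (∑-++ L M f)) (sym (ℚP.+-assoc (f x) (∑ L f) (∑ M f)))

  ∑-map : {A B : Set} (L : List A) (g : A → B) (f : B → ℚ) → ∑ (map g L) f ≡ ∑ L (λ x → f (g x))
  ∑-map []      g f = refl
  ∑-map (x ∷ L) g f = cong (f (g x) +_) (∑-map L g f)

  ∑-concatMap : {A B : Set} (L : List A) (g : A → List B) (f : B → ℚ) →
                ∑ (concatMap g L) f ≡ ∑ L (λ x → ∑ (g x) f)
  ∑-concatMap []      g f = refl
  ∑-concatMap (x ∷ L) g f = trans (∑-++ (g x) (concatMap g L) f) (cong (∑ (g x) f +_) (∑-concatMap L g f))

  ∑-swap : {A B : Set} (L : List A) (M : List B) (f : A → B → ℚ) →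
           ∑ L (λ x → ∑ M (f x)) ≡ ∑ M (λ y → ∑ L (λ x → f x y))
  ∑-swap []      M f = sym (∑-zero M)
  ∑-swap (x ∷ L) M f = trans (cong (∑ M (f x) +_) (∑-swap L M f)) (sym (∑-+ M (f x) (λ y → ∑ L (λ x' → f x' y))))

  ∑-tabulate : {A : Set} (n : ℕ) (g : Fin n → A) (f : A → ℚ) → ∑ (tabulate g) f ≡ ∑ (allFin n) (λ i → f (g i))
  ∑-tabulate zero    g f = refl
  ∑-tabulate (suc n) g f = cong (f (g zero) +_)
    (trans (∑-tabulate n (λ i → g (suc i)) f) (sym (∑-tabulate n suc (λ i → f (g i)))))

  ∑-const-list : {A : Set} (L : List A) (c : ℚ) → ∑ L (λ _ → c) ≡ ι (length L) * c
  ∑-const-list []      c = sym (ℚP.*-zeroˡ c)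
  ∑-const-list (x ∷ L) c = trans (cong (c +_) (∑-const-list L c))
    (solve 2 (λ c x → c :+ x :* c := (con 1ℚ :+ x) :* c) refl c (ι (length L)))

  ∑-length : {A : Set} (L : List A) → ∑ L (λ _ → 1ℚ) ≡ ι (length L)
  ∑-length L = trans (∑-const-list L 1ℚ) (ℚP.*-identityʳ (ι (length L)))

  ∑-const : (m : ℕ) (c : ℚ) → ∑ (allFin m) (λ _ → c) ≡ ι m * c
  ∑-const m c = trans (∑-const-list (allFin m) c) (cong (λ l → ι l * c) (ListP.length-tabulate {n = m} (λ i → i)))

  ∑∑-separable : {A B : Set} (L : List A) (M : List B) (f : A → ℚ) (g : B → ℚ) (K : ℚ) →
    ∑ L (λ x → ∑ M (λ y → f x + g y + K)) ≡ ι (length M) * (∑ L f + ι (length L) * K) + ι (length L) * ∑ M g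
  ∑∑-separable L M f g K = begin
      ∑ L (λ x → ∑ M (λ y → f x + g y + K))
        ≡⟨ ∑-cong L (λ x → trans (∑-cong M (λ y → solve 3 (λ a b k → a :+ b :+ k := (a :+ k) :+ b) refl (f x) (g y) K))
                                 (trans (∑-+ M (λ _ → f x + K) g) (cong (_+ ∑ M g) (∑-const-list M (f x + K))))) ⟩
      ∑ L (λ x → ι (length M) * (f x + K) + ∑ M g)
        ≡⟨ trans (∑-+ L _ _) (cong₂ _+_ (trans (∑-*ˡ L (ι (length M)) _) (cong (ι (length M) *_)
             (trans (∑-+ L f (λ _ → K)) (cong (∑ L f +_) (∑-const-list L K))))) (∑-const-list L (∑ M g))) ⟩
      ι (length M) * (∑ L f + ι (length L) * K) + ι (length L) * ∑ M g ∎
    where open ≡-Reasoning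

  [_]ℚ : Bool → ℚ
  [ b ]ℚ = if b then 1ℚ else 0ℚ

  [∧] : (a b : Bool) → [ a ∧ b ]ℚ ≡ [ a ]ℚ * [ b ]ℚ
  [∧] true  b = sym (ℚP.*-identityˡ [ b ]ℚ)
  [∧] false b = sym (ℚP.*-zeroˡ [ b ]ℚ)

  ∑-filter : {A : Set} (b : A → Bool) (L : List A) (f : A → ℚ) → ∑ (filterᵇ b L) f ≡ ∑ L (λ x → [ b x ]ℚ * f x)
  ∑-filter b []      f = refl
  ∑-filter b (x ∷ L) f with b x
  ... | true  = cong₂ _+_ (sym (ℚP.*-identityˡ (f x))) (∑-filter b L f)
  ... | false = trans (∑-filter b L f) (sym (trans (cong (_+ _) (ℚP.*-zeroˡ (f x))) (ℚP.+-identityˡ _)))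

  ∑-sift-Fin : (k : ℕ) (a : Fin k) (h : Fin k → ℚ) → ∑ (allFin k) (λ v → [ does (a ≟ v) ]ℚ * h v) ≡ h a
  ∑-sift-Fin (suc k) zero h = trans (cong₂ _+_ (ℚP.*-identityˡ (h zero))
      (trans (∑-tabulate k suc _) (trans (∑-cong (allFin k) (λ i → ℚP.*-zeroˡ (h (suc i)))) (∑-zero (allFin k)))))
    (ℚP.+-identityʳ (h zero))
  ∑-sift-Fin (suc k) (suc a) h = trans (cong₂ _+_ (ℚP.*-zeroˡ (h zero))
      (trans (∑-tabulate k suc _) (∑-sift-Fin k a (λ i → h (suc i)))))
    (ℚP.+-identityˡ (h (suc a)))

module FunctionSums where

  open FiniteSums
  open import Defs using (allFuns)
  open import Data.Nat as ℕ using (ℕ; zero; suc)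
  open import Data.Rational using (ℚ; 1ℚ; _*_)
  import Data.Rational.Properties as ℚP
  open import Data.Fin using (Fin; zero; suc; _≟_)
  open import Data.List using (allFin)
  open import Data.List.Relation.Unary.Any using (Any; here)
  import Data.List.Relation.Unary.Any as Any
  open import Data.List.Relation.Unary.Any.Properties using (concatMap⁺; map⁺; tabulate⁺)
  open import Data.Bool using (Bool; true; _∧_)
  open import Relation.Nullary using (does; yes; no)
  open import Relation.Binary.PropositionalEquality
  open import Data.Empty using (⊥-elim)

  -- allFuns m k enumerates functions, which Agda compares only pointwise; the
  -- quantities summed over it must therefore respect pointwise equality.
  Extensional : {A B : Set} → ((A → B) → ℚ) → Set
  Extensional G = ∀ g g' → g ≗ g' → G g ≡ G g'

  cons : {m k : ℕ} → Fin k → (Fin m → Fin k) → Fin (suc m) → Fin k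
  cons v g zero    = v
  cons v g (suc i) = g i

  cons-cong : {m k : ℕ} (v : Fin k) {g g' : Fin m → Fin k} → g ≗ g' → cons v g ≗ cons v g'
  cons-cong v eq zero    = refl
  cons-cong v eq (suc i) = eq i

  ∑-allFuns-suc : (m k : ℕ) (F : (Fin (suc m) → Fin k) → ℚ) → Extensional F →
    ∑ (allFuns (suc m) k) F ≡ ∑ (allFin k) (λ v → ∑ (allFuns m k) (λ g → F (cons v g)))
  ∑-allFuns-suc m k F ext = trans (∑-concatMap (allFin k) _ F) (∑-cong (allFin k) (λ v →
    trans (∑-map (allFuns m k) _ F) (∑-cong (allFuns m k) (λ g → ext _ _ (λ { zero → refl ; (suc i) → refl })))))

  allFuns-complete : (m k : ℕ) (f : Fin m → Fin k) → Any (_≗ f) (allFuns m k)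
  allFuns-complete zero    k f = here (λ ())
  allFuns-complete (suc m) k f = concatMap⁺ _ (tabulate⁺ (f zero) (map⁺
    (Any.map (λ g≗ → λ { zero → refl ; (suc i) → g≗ i }) (allFuns-complete m k (λ i → f (suc i))))))

  _≗ᵇ_ : {m k : ℕ} → (Fin m → Fin k) → (Fin m → Fin k) → Bool
  _≗ᵇ_ {zero}  f g = true
  _≗ᵇ_ {suc m} f g = does (f zero ≟ g zero) ∧ ((λ i → f (suc i)) ≗ᵇ (λ i → g (suc i)))

  ≗ᵇ-sound : {m k : ℕ} (f g : Fin m → Fin k) → f ≗ᵇ g ≡ true → f ≗ g
  ≗ᵇ-sound {suc m} f g e i with f zero ≟ g zero | i
  ... | yes f0≡g0 | zero  = f0≡g0
  ... | yes _     | suc j = ≗ᵇ-sound (λ i → f (suc i)) (λ i → g (suc i)) e j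

  ≗ᵇ-complete : {m k : ℕ} (f g : Fin m → Fin k) → f ≗ g → f ≗ᵇ g ≡ true
  ≗ᵇ-complete {zero}  f g eq = refl
  ≗ᵇ-complete {suc m} f g eq with f zero ≟ g zero
  ... | yes _   = ≗ᵇ-complete (λ i → f (suc i)) (λ i → g (suc i)) (λ i → eq (suc i))
  ... | no f0≢g0 = ⊥-elim (f0≢g0 (eq zero))

  ≗ᵇ-respʳ : {m k : ℕ} (f : Fin m → Fin k) {g g' : Fin m → Fin k} → g ≗ g' → f ≗ᵇ g ≡ f ≗ᵇ g'
  ≗ᵇ-respʳ {zero}  f eq = refl
  ≗ᵇ-respʳ {suc m} f eq = cong₂ _∧_ (cong (λ z → does (f zero ≟ z)) (eq zero)) (≗ᵇ-respʳ (λ i → f (suc i)) (λ i → eq (suc i)))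

  δ : {m k : ℕ} → (Fin m → Fin k) → (Fin m → Fin k) → ℚ
  δ f g = [ f ≗ᵇ g ]ℚ

  ∑-sift : (m k : ℕ) (f : Fin m → Fin k) (G : (Fin m → Fin k) → ℚ) → Extensional G →
           ∑ (allFuns m k) (λ g → δ f g * G g) ≡ G f
  ∑-sift zero    k f G ext = trans (ℚP.+-identityʳ _) (trans (ℚP.*-identityˡ _) (ext _ f (λ ())))
  ∑-sift (suc m) k f G ext = begin
      ∑ (allFuns (suc m) k) (λ g → δ f g * G g)
        ≡⟨ ∑-allFuns-suc m k (λ g → δ f g * G g) (λ g g' eq → cong₂ _*_ (cong [_]ℚ (≗ᵇ-respʳ f eq)) (ext g g' eq)) ⟩
      ∑ (allFin k) (λ v → ∑ (allFuns m k) (λ g → δ f (cons v g) * G (cons v g)))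
        ≡⟨ ∑-cong (allFin k) (λ v → trans (∑-cong (allFuns m k) (λ g → factor v g)) (∑-*ˡ (allFuns m k) [ does (f zero ≟ v) ]ℚ _)) ⟩
      ∑ (allFin k) (λ v → [ does (f zero ≟ v) ]ℚ * ∑ (allFuns m k) (λ g → δ f' g * G (cons v g)))
        ≡⟨ ∑-cong (allFin k) (λ v → cong ([ does (f zero ≟ v) ]ℚ *_)
             (∑-sift m k f' (λ g → G (cons v g)) (λ g g' eq → ext _ _ (cons-cong v eq)))) ⟩
      ∑ (allFin k) (λ v → [ does (f zero ≟ v) ]ℚ * G (cons v f'))
        ≡⟨ ∑-sift-Fin k (f zero) (λ v → G (cons v f')) ⟩
      G (cons (f zero) f')
        ≡⟨ ext _ _ (λ { zero → refl ; (suc i) → refl }) ⟩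
      G f ∎
    where
    open ≡-Reasoning
    f' : Fin m → Fin k
    f' i = f (suc i)
    factor : ∀ v g → δ f (cons v g) * G (cons v g) ≡ [ does (f zero ≟ v) ]ℚ * (δ f' g * G (cons v g))
    factor v g = trans (cong (_* G (cons v g)) ([∧] (does (f zero ≟ v)) (f' ≗ᵇ g)))
                       (ℚP.*-assoc [ does (f zero ≟ v) ]ℚ (δ f' g) (G (cons v g)))

  ∑-δ : (m k : ℕ) (f : Fin m → Fin k) → ∑ (allFuns m k) (δ f) ≡ 1ℚ
  ∑-δ m k f = trans (∑-cong (allFuns m k) (λ g → sym (ℚP.*-identityʳ (δ f g)))) (∑-sift m k f (λ _ → 1ℚ) (λ _ _ _ → refl))

module LinearExtensions where

  open FiniteSums
  open FunctionSums
  open BooleanTests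
  open RationalArithmetic
  open import Defs
  open import Data.Nat as ℕ using (ℕ; zero; suc; _<_; _≤_; z≤n; s≤s; _<?_)
  import Data.Nat.Properties as ℕP
  open import Data.Rational using (ℚ; 1ℚ; _*_)
  import Data.Rational.Properties as ℚP
  open import Data.Fin using (Fin; zero; suc; toℕ; _≟_; punchOut; fromℕ<)
  import Data.Fin.Properties as FinP
  open import Data.List using (length)
  import Data.List.Relation.Unary.Any as Any
  import Data.List.Properties as ListP
  open import Data.Bool using (Bool; true; false; _∧_; _∨_; not; if_then_else_)
  import Data.Bool as Bool
  open import Data.Product using (Σ; _,_)
  open import Relation.Nullary using (yes; no; does)
  open import Relation.Nullary.Decidable using (dec-true; dec-false)
  open import Relation.Binary using (tri<; tri≈; tri>)
  open import Relation.Binary.PropositionalEquality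
  open import Data.Empty using (⊥-elim)

  Injective : {m k : ℕ} → (Fin m → Fin k) → Set
  Injective σ = ∀ i j → σ i ≡ σ j → i ≡ j

  injective⇒onto : {m : ℕ} (σ : Fin m → Fin m) → Injective σ → ∀ k → Σ (Fin m) (λ i → σ i ≡ k)
  injective⇒onto {suc m} σ inj k with FinP.any? (λ i → σ i ≟ k)
  ... | yes hit = hit
  ... | no miss = ⊥-elim (ℕP.<-irrefl refl (FinP.injective⇒≤ {f = squeeze} squeeze-injective))
    where
    avoids : ∀ i → k ≢ σ i
    avoids i e = miss (i , sym e)
    squeeze : Fin (suc m) → Fin m
    squeeze i = punchOut (avoids i)
    squeeze-injective : ∀ {x y} → squeeze x ≡ squeeze y → x ≡ y
    squeeze-injective {x} {y} e = inj x y (FinP.punchOut-injective (avoids x) (avoids y) e)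

  countTrue : (m : ℕ) → (Fin m → Bool) → ℕ
  countTrue zero    p = 0
  countTrue (suc m) p = (if p zero then 1 else 0) ℕ.+ countTrue m (λ i → p (suc i))

  countTrue-mono : (m : ℕ) (p q : Fin m → Bool) → (∀ i → p i ≡ true → q i ≡ true) → countTrue m p ≤ countTrue m q
  countTrue-mono zero    p q p⇒q = z≤n
  countTrue-mono (suc m) p q p⇒q with p zero in p₀ | q zero in q₀
  ... | true  | true  = s≤s (countTrue-mono m _ _ (λ i → p⇒q (suc i)))
  ... | true  | false = ⊥-elim (true≢false (trans (sym (p⇒q zero p₀)) q₀))
  ... | false | true  = ℕP.m≤n⇒m≤1+n (countTrue-mono m _ _ (λ i → p⇒q (suc i)))
  ... | false | false = countTrue-mono m _ _ (λ i → p⇒q (suc i))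

  countTrue-strict : (m : ℕ) (p q : Fin m → Bool) → (∀ i → p i ≡ true → q i ≡ true) →
                     (w : Fin m) → q w ≡ true → p w ≡ false → countTrue m p < countTrue m q
  countTrue-strict (suc m) p q p⇒q zero qw pw rewrite qw | pw = s≤s (countTrue-mono m _ _ (λ i → p⇒q (suc i)))
  countTrue-strict (suc m) p q p⇒q (suc w) qw pw with p zero in p₀ | q zero in q₀
  ... | true  | true  = s≤s (countTrue-strict m _ _ (λ i → p⇒q (suc i)) w qw pw)
  ... | true  | false = ⊥-elim (true≢false (trans (sym (p⇒q zero p₀)) q₀))
  ... | false | true  = s≤s (ℕP.<⇒≤ (countTrue-strict m _ _ (λ i → p⇒q (suc i)) w qw pw))
  ... | false | false = countTrue-strict m _ _ (λ i → p⇒q (suc i)) w qw pw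

  countTrue-all : (m : ℕ) → countTrue m (λ _ → true) ≡ m
  countTrue-all zero    = refl
  countTrue-all (suc m) = cong suc (countTrue-all m)

  module _ {m : ℕ} (R : Rel (Fin m) 0ℓ) (R? : Decidable R) where

    Monotone : (Fin m → Fin m) → Set
    Monotone σ = ∀ i j → R i j → toℕ (σ i) ≤ toℕ (σ j)

    isLinExt : (Fin m → Fin m) → Bool
    isLinExt σ = isBijection R R? σ ∧ isMonotone R R? σ

    isLinExt⇒injective : ∀ σ → isLinExt σ ≡ true → Injective σ
    isLinExt⇒injective σ e i j σi≡σj with i ≟ j
    ... | yes i≡j = i≡j
    ... | no i≢j  = ⊥-elim (true≢false (trans (sym distinct) (cong₂ (λ a b → not a ∨ b)
                      (dec-true (σ i ≟ σ j) σi≡σj) (dec-false (i ≟ j) i≢j))))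
      where
      distinct = all-allFin⁻ m _ (all-allFin⁻ m _ (∧-true⁻ˡ (∧-true⁻ˡ e)) i) j

    isLinExt⇒monotone : ∀ σ → isLinExt σ ≡ true → Monotone σ
    isLinExt⇒monotone σ e i j r with all-allFin⁻ m _ (all-allFin⁻ m _ (∧-true⁻ʳ {isBijection R R? σ} e) i) j
    ... | ordered rewrite dec-true (R? i j) r = from-does (σ i FinP.≤? σ j) ordered

    linExt⇒isLinExt : ∀ σ → Injective σ → Monotone σ → isLinExt σ ≡ true
    linExt⇒isLinExt σ inj mono = ∧-true⁺
      (∧-true⁺ (all-allFin⁺ m _ (λ i → all-allFin⁺ m _ (distinct i)))
               (all-allFin⁺ m _ (λ k → let (i , σi≡k) = injective⇒onto σ inj k
                                        in any-allFin⁺ m _ i (dec-true (σ i ≟ k) σi≡k))))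
      (all-allFin⁺ m _ (λ i → all-allFin⁺ m _ (ordered i)))
      where
      distinct : ∀ i j → not (does (σ i ≟ σ j)) ∨ does (i ≟ j) ≡ true
      distinct i j with σ i ≟ σ j
      ... | yes σi≡σj rewrite dec-true (i ≟ j) (inj i j σi≡σj) = refl
      ... | no _ = refl
      ordered : ∀ i j → not (does (R? i j)) ∨ does (σ i FinP.≤? σ j) ≡ true
      ordered i j with R? i j
      ... | yes r = dec-true (σ i FinP.≤? σ j) (mono i j r)
      ... | no _  = refl

    isLinExt-resp : ∀ σ σ' → σ ≗ σ' → isLinExt σ ≡ isLinExt σ'
    isLinExt-resp σ σ' eq = bool-ext _ _ (transport σ σ' eq) (transport σ' σ (λ i → sym (eq i)))
      where
      transport : ∀ σ σ' → σ ≗ σ' → isLinExt σ ≡ true → isLinExt σ' ≡ true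
      transport σ σ' eq e = linExt⇒isLinExt σ'
        (λ i j e' → isLinExt⇒injective σ e i j (trans (eq i) (trans e' (sym (eq j)))))
        (λ i j r → subst₂ (λ a b → toℕ a ≤ toℕ b) (eq i) (eq j) (isLinExt⇒monotone σ e i j r))

    ∑-Δ : (T : (Fin m → Fin m) → ℚ) → ∑ (Δ R R?) T ≡ ∑ (allFuns m m) (λ σ → [ isLinExt σ ]ℚ * T σ)
    ∑-Δ T = ∑-filter isLinExt (allFuns m m) T

    QLB-total : 1 ≤ length (Δ R R?) → QLB R R? * ι (length (Δ R R?)) ≡ ∑ (Δ R R?) (qlbTerm R R?)
    QLB-total nonempty with length (Δ R R?) | nonempty
    ... | suc k | _ = *inv*ι (∑ (Δ R R?) (qlbTerm R R?)) k

    ∑-Δ-cong : {f g : (Fin m → Fin m) → ℚ} → (∀ σ → isLinExt σ ≡ true → f σ ≡ g σ) → ∑ (Δ R R?) f ≡ ∑ (Δ R R?) g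
    ∑-Δ-cong {f} {g} eq = trans (∑-Δ f) (trans (∑-cong (allFuns m m) on-Δ) (sym (∑-Δ g)))
      where
      on-Δ : ∀ σ → [ isLinExt σ ]ℚ * f σ ≡ [ isLinExt σ ]ℚ * g σ
      on-Δ σ with isLinExt σ in e
      ... | true  = cong (1ℚ *_) (eq σ e)
      ... | false = trans (ℚP.*-zeroˡ (f σ)) (sym (ℚP.*-zeroˡ (g σ)))

    -- Every partial order on Fin m has a linear extension: rank the elements by
    -- (size of their down-set, index), which is a strict total order refining R.
    module CanonicalExtension (po : IsPartialOrder _≡_ R) where
      open IsPartialOrder po using (antisym) renaming (trans to R-trans; reflexive to R-reflexive)

      below : Fin m → ℕ
      below i = countTrue m (λ j → does (R? j i))

      below-strict : ∀ i j → R i j → i ≢ j → below i < below j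
      below-strict i j r i≢j = countTrue-strict m _ _
        (λ k k≤i → dec-true (R? k j) (R-trans (from-does (R? k i) k≤i) r)) j
        (dec-true (R? j j) (R-reflexive refl)) (dec-false (R? j i) (λ r' → i≢j (antisym r r')))

      key : Fin m → ℕ
      key i = below i ℕ.* m ℕ.+ toℕ i

      key-mono : ∀ i j → below i < below j → key i < key j
      key-mono i j lt = ℕP.<-≤-trans (ℕP.+-monoʳ-< (below i ℕ.* m) (FinP.toℕ<n i))
        (ℕP.≤-trans (subst (_≤ below j ℕ.* m) (ℕP.+-comm m (below i ℕ.* m)) (ℕP.*-monoˡ-≤ m lt))
                    (ℕP.m≤m+n (below j ℕ.* m) (toℕ j)))

      key-injective : ∀ i j → key i ≡ key j → i ≡ j
      key-injective i j e with ℕP.<-cmp (below i) (below j)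
      ... | tri< lt _ _ = ⊥-elim (ℕP.<-irrefl e (key-mono i j lt))
      ... | tri> _ _ gt = ⊥-elim (ℕP.<-irrefl (sym e) (key-mono j i gt))
      ... | tri≈ _ b≡ _ = FinP.toℕ-injective
            (ℕP.+-cancelˡ-≡ (below i ℕ.* m) _ _ (trans e (cong (λ z → z ℕ.* m ℕ.+ toℕ j) (sym b≡))))

      rank : Fin m → ℕ
      rank i = countTrue m (λ j → does (key j <? key i))

      rank<m : ∀ i → rank i < m
      rank<m i = subst (rank i <_) (countTrue-all m)
        (countTrue-strict m _ _ (λ _ _ → refl) i refl (dec-false (key i <? key i) (ℕP.<-irrefl refl)))

      rank-mono : ∀ i j → key i < key j → rank i < rank j
      rank-mono i j lt = countTrue-strict m _ _
        (λ k k<i → dec-true (key k <? key j) (ℕP.<-trans (from-does (key k <? key i) k<i) lt)) i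
        (dec-true (key i <? key j) lt) (dec-false (key i <? key i) (ℕP.<-irrefl refl))

      extension : Fin m → Fin m
      extension i = fromℕ< (rank<m i)

      toℕ-extension : ∀ i → toℕ (extension i) ≡ rank i
      toℕ-extension i = FinP.toℕ-fromℕ< (rank<m i)

      rank-cong : ∀ i j → extension i ≡ extension j → rank i ≡ rank j
      rank-cong i j e = trans (sym (toℕ-extension i)) (trans (cong toℕ e) (toℕ-extension j))

      extension-injective : Injective extension
      extension-injective i j e with ℕP.<-cmp (key i) (key j)
      ... | tri< lt _ _ = ⊥-elim (ℕP.<-irrefl (rank-cong i j e) (rank-mono i j lt))
      ... | tri> _ _ gt = ⊥-elim (ℕP.<-irrefl (rank-cong j i (sym e)) (rank-mono j i gt))
      ... | tri≈ _ k≡ _ = key-injective i j k≡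

      extension-monotone : Monotone extension
      extension-monotone i j r with i ≟ j
      ... | yes refl = ℕP.≤-refl
      ... | no i≢j   = subst₂ _≤_ (sym (toℕ-extension i)) (sym (toℕ-extension j))
                         (ℕP.<⇒≤ (rank-mono i j (key-mono i j (below-strict i j r i≢j))))

    Δ-nonempty : IsPartialOrder _≡_ R → 1 ≤ length (Δ R R?)
    Δ-nonempty po = ListP.filter-some (λ σ → isLinExt σ Bool.≟ true)
      (Any.map (λ σ≗ext → trans (isLinExt-resp _ _ σ≗ext) (linExt⇒isLinExt extension extension-injective extension-monotone))
               (allFuns-complete m m extension))
      where open CanonicalExtension po

module Shuffles where

  open FiniteSums
  open FunctionSums
  open import Data.Nat as ℕ using (ℕ; zero; suc; _<_; _≤_; z≤n; s≤s)
  import Data.Nat.Properties as ℕP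
  open import Data.Rational using (ℚ; 1ℚ; _*_)
  import Data.Rational.Properties as ℚP
  open import Data.Fin using (Fin; zero; suc; toℕ)
  open import Data.Bool using (Bool; true; false; if_then_else_; T)
  open import Relation.Binary.PropositionalEquality

  -- A merge of P and Q is described by a word Fin (n₁ + n₂) → Colour with n₁
  -- letters c₁ (positions taken by P) and n₂ letters c₂ (positions taken by Q).
  Colour : Set
  Colour = Fin 2

  c₁ c₂ : Colour
  c₁ = zero
  c₂ = suc zero

  other : Colour → Colour
  other zero       = c₂
  other (suc zero) = c₁

  _==_ : Colour → Colour → Bool
  zero       == zero       = true
  zero       == suc zero   = false
  suc zero   == zero       = false
  suc zero   == suc zero   = true

  ==-sound : ∀ a c → a == c ≡ true → a ≡ c
  ==-sound zero       zero       _ = refl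
  ==-sound zero       (suc zero) ()
  ==-sound (suc zero) zero       ()
  ==-sound (suc zero) (suc zero) _ = refl

  ==-refl : ∀ c → c == c ≡ true
  ==-refl zero       = refl
  ==-refl (suc zero) = refl

  ==-other : ∀ c → other c == c ≡ false
  ==-other zero       = refl
  ==-other (suc zero) = refl

  c₁-or-c₂ : ∀ a → a == c₁ ≡ false → a == c₂ ≡ true
  c₁-or-c₂ (suc zero) _ = refl

  c₂⇒not-c₁ : ∀ a → a == c₂ ≡ true → a == c₁ ≡ false
  c₂⇒not-c₁ (suc zero) _ = refl

  ≡ᵇ-sound : ∀ m k → (m ℕ.≡ᵇ k) ≡ true → m ≡ k
  ≡ᵇ-sound m k e = ℕP.≡ᵇ⇒≡ m k (subst T (sym e) _)

  ≡ᵇ-refl : ∀ m → (m ℕ.≡ᵇ m) ≡ true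
  ≡ᵇ-refl zero    = refl
  ≡ᵇ-refl (suc m) = ≡ᵇ-refl m

  bit : Bool → ℕ
  bit b = if b then 1 else 0

  pos-step : Bool → (ℕ → ℕ) → ℕ → ℕ
  pos-step true  posₜ zero    = zero
  pos-step true  posₜ (suc r) = suc (posₜ r)
  pos-step false posₜ r       = suc (posₜ r)

  module _ (c : Colour) where

    occ : {n : ℕ} → (Fin n → Colour) → ℕ
    occ {zero}  s = 0
    occ {suc n} s = bit (s zero == c) ℕ.+ occ (λ i → s (suc i))

    -- pos s r: the position of the r-th letter c of s (counting from 0).
    pos : {n : ℕ} → (Fin n → Colour) → ℕ → ℕ
    pos {zero}  s r = 0
    pos {suc n} s = pos-step (s zero == c) (pos (λ i → s (suc i)))

    rankAt : {n : ℕ} → (Fin n → Colour) → ℕ → ℕ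
    rankAt {zero}  s p       = 0
    rankAt {suc n} s zero    = 0
    rankAt {suc n} s (suc p) = bit (s zero == c) ℕ.+ rankAt (λ i → s (suc i)) p

    -- gapEnd s r: the 1-based position of the r-th letter c, with gapEnd s 0 = 0.
    gapEnd : {n : ℕ} → (Fin n → Colour) → ℕ → ℕ
    gapEnd s zero    = 0
    gapEnd s (suc r) = suc (pos s r)

    W : {n : ℕ} → ℕ → (Fin n → Colour) → ℚ
    W k s = [ occ s ℕ.≡ᵇ k ]ℚ

    occ-resp : {n : ℕ} {s s' : Fin n → Colour} → s ≗ s' → occ s ≡ occ s'
    occ-resp {zero}  eq = refl
    occ-resp {suc n} eq = cong₂ (λ a b → bit (a == c) ℕ.+ b) (eq zero) (occ-resp (λ i → eq (suc i)))

    pos-resp : {n : ℕ} {s s' : Fin n → Colour} → s ≗ s' → ∀ r → pos s r ≡ pos s' r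
    pos-resp {zero}  eq r = refl
    pos-resp {suc n} {s} {s'} eq r rewrite eq zero with s' zero == c | r
    ... | true  | zero   = refl
    ... | true  | suc r' = cong suc (pos-resp (λ i → eq (suc i)) r')
    ... | false | r'     = cong suc (pos-resp (λ i → eq (suc i)) r')

    rankAt-resp : {n : ℕ} {s s' : Fin n → Colour} → s ≗ s' → ∀ p → rankAt s p ≡ rankAt s' p
    rankAt-resp {zero}  eq p       = refl
    rankAt-resp {suc n} eq zero    = refl
    rankAt-resp {suc n} eq (suc p) =
      cong₂ (λ a b → bit (a == c) ℕ.+ b) (eq zero) (rankAt-resp (λ i → eq (suc i)) p)

    gapEnd-resp : {n : ℕ} {s s' : Fin n → Colour} → s ≗ s' → ∀ r → gapEnd s r ≡ gapEnd s' r
    gapEnd-resp eq zero    = refl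
    gapEnd-resp eq (suc r) = cong suc (pos-resp eq r)

    W-resp : {n : ℕ} (k : ℕ) → Extensional {Fin n} (W k)
    W-resp k s s' eq = cong (λ x → [ x ℕ.≡ᵇ k ]ℚ) (occ-resp eq)

    W-when : {n : ℕ} (k : ℕ) (s : Fin n → Colour) (x y : ℚ) → (occ s ≡ k → x ≡ y) → W k s * x ≡ W k s * y
    W-when k s x y h with occ s ℕ.≡ᵇ k in e
    ... | true  = cong (1ℚ *_) (h (≡ᵇ-sound (occ s) k e))
    ... | false = trans (ℚP.*-zeroˡ x) (sym (ℚP.*-zeroˡ y))

    pos-bound : {n : ℕ} (s : Fin n → Colour) (r : ℕ) → r < occ s → pos s r < n
    pos-bound {zero}  s r ()
    pos-bound {suc n} s r lt with s zero == c
    pos-bound {suc n} s zero    lt       | true  = s≤s z≤n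
    pos-bound {suc n} s (suc r) (s≤s lt) | true  = s≤s (pos-bound (λ j → s (suc j)) r lt)
    pos-bound {suc n} s r       lt       | false = s≤s (pos-bound (λ j → s (suc j)) r lt)

    pos-colour : {n : ℕ} (s : Fin n → Colour) (r : ℕ) → r < occ s → (i : Fin n) → toℕ i ≡ pos s r → s i == c ≡ true
    pos-colour {zero}  s r () i e
    pos-colour {suc n} s r lt i e with s zero == c in eq
    pos-colour {suc n} s zero    lt       zero    e  | true = eq
    pos-colour {suc n} s zero    lt       (suc i) () | true
    pos-colour {suc n} s (suc r) (s≤s lt) zero    () | true
    pos-colour {suc n} s (suc r) (s≤s lt) (suc i) e  | true  = pos-colour (λ j → s (suc j)) r lt i (ℕP.suc-injective e)
    pos-colour {suc n} s r       lt       zero    () | false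
    pos-colour {suc n} s r       lt       (suc i) e  | false = pos-colour (λ j → s (suc j)) r lt i (ℕP.suc-injective e)

    rankAt-pos : {n : ℕ} (s : Fin n → Colour) (r : ℕ) → r < occ s → rankAt s (pos s r) ≡ r
    rankAt-pos {zero}  s r ()
    rankAt-pos {suc n} s r lt with s zero == c in eq
    rankAt-pos {suc n} s zero    lt       | true = refl
    rankAt-pos {suc n} s (suc r) (s≤s lt) | true  rewrite eq = cong suc (rankAt-pos (λ j → s (suc j)) r lt)
    rankAt-pos {suc n} s r       lt       | false rewrite eq = rankAt-pos (λ j → s (suc j)) r lt

    pos-rankAt : {n : ℕ} (s : Fin n → Colour) (i : Fin n) → s i == c ≡ true → pos s (rankAt s (toℕ i)) ≡ toℕ i
    pos-rankAt {suc n} s zero    e rewrite e = refl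
    pos-rankAt {suc n} s (suc i) e with s zero == c
    ... | true  = cong suc (pos-rankAt (λ j → s (suc j)) i e)
    ... | false = cong suc (pos-rankAt (λ j → s (suc j)) i e)

    rankAt-bound : {n : ℕ} (s : Fin n → Colour) (i : Fin n) → s i == c ≡ true → rankAt s (toℕ i) < occ s
    rankAt-bound {suc n} s zero    e rewrite e = s≤s z≤n
    rankAt-bound {suc n} s (suc i) e with s zero == c
    ... | true  = s≤s (rankAt-bound (λ j → s (suc j)) i e)
    ... | false = rankAt-bound (λ j → s (suc j)) i e

    pos-mono : {n : ℕ} (s : Fin n → Colour) {r r' : ℕ} → r ≤ r' → pos s r ≤ pos s r'
    pos-mono {zero}  s le = z≤n
    pos-mono {suc n} s {r} {r'} le with s zero == c
    pos-mono {suc n} s {zero}  {r'}     le       | true  = z≤n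
    pos-mono {suc n} s {suc r} {suc r'} (s≤s le) | true  = s≤s (pos-mono (λ j → s (suc j)) le)
    pos-mono {suc n} s {r}     {r'}     le       | false = s≤s (pos-mono (λ j → s (suc j)) le)

    rankAt-mono : {n : ℕ} (s : Fin n → Colour) {p p' : ℕ} → p ≤ p' → rankAt s p ≤ rankAt s p'
    rankAt-mono {zero}  s le = z≤n
    rankAt-mono {suc n} s {zero}  le = z≤n
    rankAt-mono {suc n} s {suc p} {suc p'} (s≤s le) =
      ℕP.+-monoʳ-≤ (bit (s zero == c)) (rankAt-mono (λ j → s (suc j)) le)

    gapEnd-mono : {n : ℕ} (s : Fin n → Colour) {r r' : ℕ} → r ≤ r' → gapEnd s r ≤ gapEnd s r'
    gapEnd-mono s {zero}  le       = z≤n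
    gapEnd-mono s {suc r} (s≤s le) = s≤s (pos-mono s le)

  occ-c₁+c₂ : {n : ℕ} (s : Fin n → Colour) → occ c₁ s ℕ.+ occ c₂ s ≡ n
  occ-c₁+c₂ {zero}  s = refl
  occ-c₁+c₂ {suc n} s with s zero
  ... | zero     = cong suc (occ-c₁+c₂ (λ j → s (suc j)))
  ... | suc zero = trans (ℕP.+-suc (occ c₁ (λ j → s (suc j))) _) (cong suc (occ-c₁+c₂ (λ j → s (suc j))))

module GapSums where

  open FiniteSums
  open FunctionSums
  open RationalArithmetic
  open Shuffles
  open import Defs using (allFuns; H)
  open import Data.Nat as ℕ using (ℕ; zero; suc; _∸_; _<_; _≤_; z≤n; s≤s)
  import Data.Nat.Properties as ℕP
  open import Data.Rational using (ℚ; 0ℚ; _+_; _*_; _-_)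
  import Data.Rational.Properties as ℚP
  open import Data.Fin using (Fin; zero; suc)
  open import Data.List using (allFin)
  open import Data.Bool using (true; false)
  open import Data.Sum using (_⊎_; inj₁; inj₂)
  open import Relation.Binary.PropositionalEquality
  open import Data.Rational.Solver
  open +-*-Solver

  binom : ℕ → ℕ → ℕ
  binom zero    zero    = 1
  binom zero    (suc k) = 0
  binom (suc n) zero    = 1
  binom (suc n) (suc k) = binom n k ℕ.+ binom n (suc k)

  binom-n-0 : ∀ n → binom n 0 ≡ 1
  binom-n-0 zero    = refl
  binom-n-0 (suc n) = refl

  binom-n-1 : ∀ n → binom n 1 ≡ n
  binom-n-1 zero    = refl
  binom-n-1 (suc n) = cong₂ ℕ._+_ (binom-n-0 n) (binom-n-1 n)

  binom-pos : ∀ n k → k ≤ n → 1 ≤ binom n k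
  binom-pos zero    zero    _        = s≤s z≤n
  binom-pos (suc n) zero    _        = s≤s z≤n
  binom-pos (suc n) (suc k) (s≤s le) = ℕP.≤-trans (binom-pos n k le) (ℕP.m≤m+n (binom n k) (binom n (suc k)))

  binom-absorb : ∀ n k → suc n ℕ.* binom n k ≡ suc k ℕ.* binom (suc n) (suc k)
  binom-absorb zero    zero    = refl
  binom-absorb zero    (suc k) = sym (ℕP.*-zeroʳ (suc (suc k)))
  binom-absorb (suc n) zero    = trans (ℕP.*-identityʳ (suc (suc n)))
    (sym (trans (ℕP.*-identityˡ _) (cong suc (cong₂ ℕ._+_ (binom-n-0 n) (binom-n-1 n)))))
  binom-absorb (suc n) (suc k) = begin
      (2 ℕ.+ n) ℕ.* (x ℕ.+ y)
        ≡⟨ N.solve 3 (λ n x y → (N.con 2 N.:+ n) N.:* (x N.:+ y) N.:= (x N.:+ y) N.:+ ((N.con 1 N.:+ n) N.:* x N.:+ (N.con 1 N.:+ n) N.:* y)) refl n x y ⟩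
      (x ℕ.+ y) ℕ.+ (suc n ℕ.* x ℕ.+ suc n ℕ.* y)
        ≡⟨ cong₂ (λ a b → (x ℕ.+ y) ℕ.+ (a ℕ.+ b)) (binom-absorb n k) (binom-absorb n (suc k)) ⟩
      (x ℕ.+ y) ℕ.+ (suc k ℕ.* (x ℕ.+ y) ℕ.+ (2 ℕ.+ k) ℕ.* z)
        ≡⟨ N.solve 4 (λ k x y z → (x N.:+ y) N.:+ ((N.con 1 N.:+ k) N.:* (x N.:+ y) N.:+ (N.con 2 N.:+ k) N.:* z)
                                   N.:= (N.con 2 N.:+ k) N.:* ((x N.:+ y) N.:+ z)) refl k x y z ⟩
      (2 ℕ.+ k) ℕ.* ((x ℕ.+ y) ℕ.+ z) ∎
    where
    open ≡-Reasoning
    import Data.Nat.Solver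
    module N = Data.Nat.Solver.+-*-Solver
    x = binom n k
    y = binom n (suc k)
    z = binom (suc n) (suc (suc k))

  binom-inv : ∀ n k → ι (binom n k) * inv k ≡ ι (binom (suc n) (suc k)) * inv n
  binom-inv n k = begin
      x * inv k                             ≡⟨ cong (_* inv k) (sym (*ι*inv x n)) ⟩
      x * ι (suc n) * inv n * inv k         ≡⟨ solve 4 (λ x a i j → x :* a :* i :* j := a :* x :* j :* i) refl x (ι (suc n)) (inv n) (inv k) ⟩
      ι (suc n) * x * inv k * inv n         ≡⟨ cong (λ z → z * inv k * inv n) absorbℚ ⟩
      ι (suc k) * X * inv k * inv n         ≡⟨ cong (_* inv n) (trans (cong (_* inv k) (ℚP.*-comm (ι (suc k)) X)) (*ι*inv X k)) ⟩
      X * inv n                             ∎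
    where
    open ≡-Reasoning
    x = ι (binom n k)
    X = ι (binom (suc n) (suc k))
    absorbℚ : ι (suc n) * x ≡ ι (suc k) * X
    absorbℚ = trans (sym (ι-* (suc n) (binom n k))) (trans (cong ι (binom-absorb n k)) (ι-* (suc k) (binom (suc n) (suc k))))

  -- The recursion step of the gap sums: Pascal's rule weighted by harmonic numbers.
  pascal-harmonic : ∀ n k E →
    ι (binom n k) * (E + H n - H k) + ι (binom n (suc k)) * (E + H n - H (suc k))
      ≡ ι (binom (suc n) (suc k)) * (E + H (suc n) - H (suc k))
  pascal-harmonic n k E = begin
      x * (E + H n - H k) + y * (E + H n - (H k + inv k))
        ≡⟨ solve 6 (λ x y E a b i → x :* (E :+ a :- b) :+ y :* (E :+ a :- (b :+ i))
                                  := (x :+ y) :* (E :+ a :- (b :+ i)) :+ x :* i) refl x y E (H n) (H k) (inv k) ⟩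
      (x + y) * (E + H n - (H k + inv k)) + x * inv k
        ≡⟨ cong₂ (λ u v → u * (E + H n - (H k + inv k)) + v) (sym (ι-+ (binom n k) _)) (binom-inv n k) ⟩
      X * (E + H n - (H k + inv k)) + X * inv n
        ≡⟨ solve 6 (λ X E a b i j → X :* (E :+ a :- (b :+ i)) :+ X :* j := X :* (E :+ (a :+ j) :- (b :+ i))) refl X E (H n) (H k) (inv k) (inv n) ⟩
      X * (E + H (suc n) - H (suc k)) ∎
    where
    open ≡-Reasoning
    x = ι (binom n k)
    y = ι (binom n (suc k))
    X = ι (binom (suc n) (suc k))

  split-first : (n : ℕ) (c : Colour) (F : (Fin (suc n) → Colour) → ℚ) → Extensional F →
    ∑ (allFuns (suc n) 2) F ≡ ∑ (allFuns n 2) (λ s → F (cons c s)) + ∑ (allFuns n 2) (λ s → F (cons (other c) s))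
  split-first n zero       F ext = trans (∑-allFuns-suc n 2 F ext) (cong (F₁ +_) (ℚP.+-identityʳ F₂))
    where
    F₁ = ∑ (allFuns n 2) (λ s → F (cons c₁ s))
    F₂ = ∑ (allFuns n 2) (λ s → F (cons c₂ s))
  split-first n (suc zero) F ext = trans (∑-allFuns-suc n 2 F ext)
    (trans (cong (F₁ +_) (ℚP.+-identityʳ F₂)) (ℚP.+-comm F₁ F₂))
    where
    F₁ = ∑ (allFuns n 2) (λ s → F (cons c₁ s))
    F₂ = ∑ (allFuns n 2) (λ s → F (cons c₂ s))

  W-cons-same : {n : ℕ} (c : Colour) (k : ℕ) (s : Fin n → Colour) → W c (suc k) (cons c s) ≡ W c k s
  W-cons-same zero       k s = refl
  W-cons-same (suc zero) k s = refl

  W-cons-same-0 : {n : ℕ} (c : Colour) (s : Fin n → Colour) → W c 0 (cons c s) ≡ 0ℚ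
  W-cons-same-0 zero       s = refl
  W-cons-same-0 (suc zero) s = refl

  W-cons-other : {n : ℕ} (c : Colour) (k : ℕ) (s : Fin n → Colour) → W c k (cons (other c) s) ≡ W c k s
  W-cons-other zero       k s = refl
  W-cons-other (suc zero) k s = refl

  ∑-W : (n : ℕ) (c : Colour) (k : ℕ) → ∑ (allFuns n 2) (W c k) ≡ ι (binom n k)
  ∑-W zero    c zero    = refl
  ∑-W zero    c (suc k) = ℚP.+-identityʳ 0ℚ
  ∑-W (suc n) c zero    = begin
      ∑ (allFuns (suc n) 2) (W c 0)
        ≡⟨ split-first n c (W c 0) (W-resp c 0) ⟩
      ∑ (allFuns n 2) (λ s → W c 0 (cons c s)) + ∑ (allFuns n 2) (λ s → W c 0 (cons (other c) s))
        ≡⟨ cong₂ _+_ (trans (∑-cong (allFuns n 2) (W-cons-same-0 c)) (∑-zero (allFuns n 2)))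
                     (∑-cong (allFuns n 2) (W-cons-other c 0)) ⟩
      0ℚ + ∑ (allFuns n 2) (W c 0)
        ≡⟨ trans (ℚP.+-identityˡ _) (trans (∑-W n c 0) (cong ι (binom-n-0 n))) ⟩
      ι 1 ∎
    where open ≡-Reasoning
  ∑-W (suc n) c (suc k) = begin
      ∑ (allFuns (suc n) 2) (W c (suc k))
        ≡⟨ split-first n c (W c (suc k)) (W-resp c (suc k)) ⟩
      ∑ (allFuns n 2) (λ s → W c (suc k) (cons c s)) + ∑ (allFuns n 2) (λ s → W c (suc k) (cons (other c) s))
        ≡⟨ cong₂ _+_ (∑-cong (allFuns n 2) (W-cons-same c k)) (∑-cong (allFuns n 2) (W-cons-other c (suc k))) ⟩
      ∑ (allFuns n 2) (W c k) + ∑ (allFuns n 2) (W c (suc k))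
        ≡⟨ cong₂ _+_ (∑-W n c k) (∑-W n c (suc k)) ⟩
      ι (binom n k) + ι (binom n (suc k))
        ≡⟨ sym (ι-+ (binom n k) (binom n (suc k))) ⟩
      ι (binom (suc n) (suc k)) ∎
    where open ≡-Reasoning

  snoc : {n : ℕ} → (Fin n → Colour) → Colour → Fin (suc n) → Colour
  snoc {zero}  s w i       = w
  snoc {suc n} s w zero    = s zero
  snoc {suc n} s w (suc i) = snoc (λ j → s (suc j)) w i

  snoc-cong : {n : ℕ} {s s' : Fin n → Colour} (w : Colour) → s ≗ s' → snoc s w ≗ snoc s' w
  snoc-cong {zero}  w eq i       = refl
  snoc-cong {suc n} w eq zero    = eq zero
  snoc-cong {suc n} w eq (suc i) = snoc-cong w (λ j → eq (suc j)) i

  split-last : (n : ℕ) (c : Colour) (F : (Fin (suc n) → Colour) → ℚ) → Extensional F →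
    ∑ (allFuns (suc n) 2) F ≡ ∑ (allFuns n 2) (λ s → F (snoc s c)) + ∑ (allFuns n 2) (λ s → F (snoc s (other c)))
  split-last zero    c F ext = trans (split-first zero c F ext)
    (cong₂ _+_ (cong (_+ 0ℚ) (ext _ _ (λ { zero → refl }))) (cong (_+ 0ℚ) (ext _ _ (λ { zero → refl }))))
  split-last (suc n) c F ext = begin
      ∑ (allFuns (suc (suc n)) 2) F
        ≡⟨ ∑-allFuns-suc (suc n) 2 F ext ⟩
      ∑ (allFin 2) (λ v → ∑ (allFuns (suc n) 2) (λ t → F (cons v t)))
        ≡⟨ ∑-cong (allFin 2) (λ v → split-last n c (λ t → F (cons v t)) (λ g g' eq → ext _ _ (cons-cong v eq))) ⟩
      ∑ (allFin 2) (λ v → ∑ (allFuns n 2) (λ s → F (cons v (snoc s c))) + ∑ (allFuns n 2) (λ s → F (cons v (snoc s (other c)))))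
        ≡⟨ ∑-+ (allFin 2) (λ v → ∑ (allFuns n 2) (λ s → F (cons v (snoc s c)))) (λ v → ∑ (allFuns n 2) (λ s → F (cons v (snoc s (other c))))) ⟩
      ∑ (allFin 2) (λ v → ∑ (allFuns n 2) (λ s → F (cons v (snoc s c))))
        + ∑ (allFin 2) (λ v → ∑ (allFuns n 2) (λ s → F (cons v (snoc s (other c)))))
        ≡⟨ cong₂ _+_ (regroup c) (regroup (other c)) ⟩
      ∑ (allFuns (suc n) 2) (λ s → F (snoc s c)) + ∑ (allFuns (suc n) 2) (λ s → F (snoc s (other c))) ∎
    where
    open ≡-Reasoning
    regroup : ∀ w → ∑ (allFin 2) (λ v → ∑ (allFuns n 2) (λ s → F (cons v (snoc s w)))) ≡ ∑ (allFuns (suc n) 2) (λ s → F (snoc s w))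
    regroup w = sym (trans (∑-allFuns-suc n 2 (λ s → F (snoc s w)) (λ g g' eq → ext _ _ (snoc-cong w eq)))
      (∑-cong (allFin 2) (λ v → ∑-cong (allFuns n 2) (λ s → ext (snoc (cons v s) w) (cons v (snoc s w)) (λ { zero → refl ; (suc i) → refl })))))

  occ-snoc : {n : ℕ} (c w : Colour) (s : Fin n → Colour) → occ c (snoc s w) ≡ occ c s ℕ.+ bit (w == c)
  occ-snoc {zero}  c w s = ℕP.+-identityʳ _
  occ-snoc {suc n} c w s = trans (cong (bit (s zero == c) ℕ.+_) (occ-snoc c w (λ j → s (suc j))))
    (sym (ℕP.+-assoc (bit (s zero == c)) (occ c (λ j → s (suc j))) (bit (w == c))))

  W-snoc-same : {n : ℕ} (c : Colour) (k : ℕ) (s : Fin n → Colour) → W c (suc k) (snoc s c) ≡ W c k s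
  W-snoc-same c k s = cong (λ x → [ x ℕ.≡ᵇ suc k ]ℚ)
    (trans (occ-snoc c c s) (trans (cong (λ b → occ c s ℕ.+ bit b) (==-refl c)) (ℕP.+-comm (occ c s) 1)))

  W-snoc-other : {n : ℕ} (c : Colour) (k : ℕ) (s : Fin n → Colour) → W c k (snoc s (other c)) ≡ W c k s
  W-snoc-other c k s = cong (λ x → [ x ℕ.≡ᵇ k ]ℚ)
    (trans (occ-snoc c (other c) s) (trans (cong (λ b → occ c s ℕ.+ bit b) (==-other c)) (ℕP.+-identityʳ _)))

  pos-snoc-< : {n : ℕ} (c w : Colour) (s : Fin n → Colour) (r : ℕ) → r < occ c s → pos c (snoc s w) r ≡ pos c s r
  pos-snoc-< {zero}  c w s r ()
  pos-snoc-< {suc n} c w s r lt with s zero == c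
  pos-snoc-< {suc n} c w s zero    lt       | true  = refl
  pos-snoc-< {suc n} c w s (suc r) (s≤s lt) | true  = cong suc (pos-snoc-< c w (λ j → s (suc j)) r lt)
  pos-snoc-< {suc n} c w s r       lt       | false = cong suc (pos-snoc-< c w (λ j → s (suc j)) r lt)

  pos-snoc-last : {n : ℕ} (c : Colour) (s : Fin n → Colour) → pos c (snoc s c) (occ c s) ≡ n
  pos-snoc-last {zero}  zero       s = refl
  pos-snoc-last {zero}  (suc zero) s = refl
  pos-snoc-last {suc n} c s with s zero == c
  ... | true  = cong suc (pos-snoc-last c (λ j → s (suc j)))
  ... | false = cong suc (pos-snoc-last c (λ j → s (suc j)))

  ∑-H-pos : (n : ℕ) (c : Colour) (k v : ℕ) → v < k →
    ∑ (allFuns n 2) (λ s → W c k s * H (pos c s v)) ≡ ι (binom n k) * (H v + H n - H k)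
  ∑-H-pos zero    c (suc k) v lt = trans (ℚP.+-identityʳ _)
    (trans (ℚP.*-zeroˡ (H (pos c {0} (λ ()) v))) (sym (ℚP.*-zeroˡ (H v + H zero - H (suc k)))))
  ∑-H-pos (suc n) c (suc k) v (s≤s v≤k) = begin
      ∑ (allFuns (suc n) 2) F
        ≡⟨ split-last n c F F-resp ⟩
      ∑ S (λ s → F (snoc s c)) + ∑ S (λ s → F (snoc s (other c)))
        ≡⟨ cong₂ _+_ (last-is-c (ℕP.m≤n⇒m<n∨m≡n v≤k)) last-is-other ⟩
      ι (binom n k) * (H v + H n - H k) + ι (binom n (suc k)) * (H v + H n - H (suc k))
        ≡⟨ pascal-harmonic n k (H v) ⟩
      ι (binom (suc n) (suc k)) * (H v + H (suc n) - H (suc k)) ∎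
    where
    open ≡-Reasoning
    S = allFuns n 2
    F : (Fin (suc n) → Colour) → ℚ
    F s = W c (suc k) s * H (pos c s v)
    F-resp : Extensional F
    F-resp s s' eq = cong₂ _*_ (W-resp c (suc k) s s' eq) (cong H (pos-resp c eq v))
    last-is-other : ∑ S (λ s → F (snoc s (other c))) ≡ ι (binom n (suc k)) * (H v + H n - H (suc k))
    last-is-other = trans (∑-cong S (λ s → trans (cong (_* H (pos c (snoc s (other c)) v)) (W-snoc-other c (suc k) s))
        (W-when c (suc k) s _ _ (λ e → cong H (pos-snoc-< c (other c) s v (subst (v <_) (sym e) (s≤s v≤k)))))))
      (∑-H-pos n c (suc k) v (s≤s v≤k))
    last-is-c : v < k ⊎ v ≡ k → ∑ S (λ s → F (snoc s c)) ≡ ι (binom n k) * (H v + H n - H k)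
    last-is-c (inj₁ v<k) = trans (∑-cong S (λ s → trans (cong (_* H (pos c (snoc s c) v)) (W-snoc-same c k s))
        (W-when c k s _ _ (λ e → cong H (pos-snoc-< c c s v (subst (v <_) (sym e) v<k))))))
      (∑-H-pos n c k v v<k)
    last-is-c (inj₂ refl) = begin
      ∑ S (λ s → F (snoc s c))
        ≡⟨ ∑-cong S (λ s → trans (cong (_* H (pos c (snoc s c) v)) (W-snoc-same c v s))
             (W-when c v s _ _ (λ e → cong H (trans (cong (pos c (snoc s c)) (sym e)) (pos-snoc-last c s))))) ⟩
      ∑ S (λ s → W c v s * H n)
        ≡⟨ trans (∑-*ʳ S (H n) (W c v)) (cong (_* H n) (∑-W n c v)) ⟩
      ι (binom n v) * H n
        ≡⟨ cong (ι (binom n v) *_) (solve 2 (λ a b → b := a :+ b :- a) refl (H v) (H n)) ⟩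
      ι (binom n v) * (H v + H n - H v) ∎

  gapEnd-cons-same : {n : ℕ} (c : Colour) (s : Fin n → Colour) (r : ℕ) → gapEnd c (cons c s) (suc r) ≡ suc (gapEnd c s r)
  gapEnd-cons-same zero       s zero    = refl
  gapEnd-cons-same zero       s (suc r) = refl
  gapEnd-cons-same (suc zero) s zero    = refl
  gapEnd-cons-same (suc zero) s (suc r) = refl

  gapEnd-cons-other : {n : ℕ} (c : Colour) (s : Fin n → Colour) (r : ℕ) → gapEnd c (cons (other c) s) (suc r) ≡ suc (gapEnd c s (suc r))
  gapEnd-cons-other zero       s r = refl
  gapEnd-cons-other (suc zero) s r = refl

  ∑-H-gap : (n : ℕ) (c : Colour) (k u v : ℕ) → u < v → v ≤ k →
    ∑ (allFuns n 2) (λ s → W c k s * H (gapEnd c s v ∸ gapEnd c s u ∸ 1)) ≡ ι (binom n k) * (H (v ∸ u ∸ 1) + H n - H k)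
  ∑-H-gap n c k zero (suc v) _ v<k = ∑-H-pos n c k v v<k
  ∑-H-gap zero c (suc k) (suc u) (suc v) _ _ = trans (ℚP.+-identityʳ _)
    (trans (ℚP.*-zeroˡ (H (gap {0} (λ ())))) (sym (ℚP.*-zeroˡ (H (v ∸ u ∸ 1) + H zero - H (suc k)))))
    where
    gap : {n : ℕ} → (Fin n → Colour) → ℕ
    gap s = gapEnd c s (suc v) ∸ gapEnd c s (suc u) ∸ 1
  ∑-H-gap (suc n) c (suc k) (suc u) (suc v) (s≤s u<v) (s≤s v≤k) = begin
      ∑ (allFuns (suc n) 2) F
        ≡⟨ split-first n c F F-resp ⟩
      ∑ S (λ s → F (cons c s)) + ∑ S (λ s → F (cons (other c) s))
        ≡⟨ cong₂ _+_ (∑-cong S (λ s → cong₂ _*_ (W-cons-same c k s)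
                                          (cong₂ (λ a b → H (a ∸ b ∸ 1)) (gapEnd-cons-same c s v) (gapEnd-cons-same c s u))))
                     (∑-cong S (λ s → cong₂ _*_ (W-cons-other c (suc k) s)
                                          (cong₂ (λ a b → H (a ∸ b ∸ 1)) (gapEnd-cons-other c s v) (gapEnd-cons-other c s u)))) ⟩
      ∑ S (λ s → W c k s * H (gapEnd c s v ∸ gapEnd c s u ∸ 1)) + ∑ S (λ s → W c (suc k) s * H (gapEnd c s (suc v) ∸ gapEnd c s (suc u) ∸ 1))
        ≡⟨ cong₂ _+_ (∑-H-gap n c k u v u<v v≤k) (∑-H-gap n c (suc k) (suc u) (suc v) (s≤s u<v) (s≤s v≤k)) ⟩
      ι (binom n k) * (H (v ∸ u ∸ 1) + H n - H k) + ι (binom n (suc k)) * (H (v ∸ u ∸ 1) + H n - H (suc k))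
        ≡⟨ pascal-harmonic n k (H (v ∸ u ∸ 1)) ⟩
      ι (binom (suc n) (suc k)) * (H (v ∸ u ∸ 1) + H (suc n) - H (suc k)) ∎
    where
    open ≡-Reasoning
    S = allFuns n 2
    F : (Fin (suc n) → Colour) → ℚ
    F s = W c (suc k) s * H (gapEnd c s (suc v) ∸ gapEnd c s (suc u) ∸ 1)
    F-resp : Extensional F
    F-resp s s' eq = cong₂ _*_ (W-resp c (suc k) s s' eq)
      (cong₂ (λ a b → H (a ∸ b ∸ 1)) (gapEnd-resp c eq (suc v)) (gapEnd-resp c eq (suc u)))

module PredecessorGaps where

  open FiniteSums
  open FunctionSums
  open BooleanTests
  open LinearExtensions
  open import Defs
  open import Data.Nat as ℕ using (ℕ; suc; _<_; _≤_; z≤n; s≤s; _∸_; _⊓_)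
  import Data.Nat.Properties as ℕP
  open import Data.Fin using (Fin; toℕ; _≟_)
  import Data.Fin.Properties as FinP
  open import Data.List using (List; []; _∷_; map; foldr; allFin)
  open import Data.List.Relation.Unary.All using (All; []; _∷_)
  import Data.List.Relation.Unary.All as All
  import Data.List.Relation.Unary.All.Properties as AllP
  open import Data.List.Relation.Unary.All.Properties using (all-filter)
  import Data.List.Properties as ListP
  open import Data.Bool using (true; _∧_; not)
  import Data.Bool as Bool
  open import Data.Sum using (inj₁; inj₂)
  open import Relation.Nullary using (does)
  open import Relation.Binary.PropositionalEquality

  minOr : List ℕ → ℕ → ℕ
  minOr []       d = d
  minOr (x ∷ xs) _ = foldr _⊓_ x xs

  minOr-glb : (L : List ℕ) (d k : ℕ) → k ≤ d → All (k ≤_) L → k ≤ minOr L d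
  minOr-glb []       d k k≤d _          = k≤d
  minOr-glb (x ∷ xs) d k _   (k≤x ∷ k≤) = go x xs k≤x k≤
    where
    go : ∀ x xs → k ≤ x → All (k ≤_) xs → k ≤ foldr _⊓_ x xs
    go x []       k≤x []          = k≤x
    go x (y ∷ ys) k≤x (k≤y ∷ k≤') = ℕP.⊓-glb k≤y (go x ys k≤x k≤')

  minOr-≤ : (L : List ℕ) (d k : ℕ) → d ≤ k → All (_≤ k) L → minOr L d ≤ k
  minOr-≤ []       d k d≤k _          = d≤k
  minOr-≤ (x ∷ xs) d k _   (x≤k ∷ ≤k) = go x xs x≤k ≤k
    where
    go : ∀ x xs → x ≤ k → All (_≤ k) xs → foldr _⊓_ x xs ≤ k
    go x []       x≤k []         = x≤k
    go x (y ∷ ys) x≤k (y≤k ∷ ≤k') = ℕP.≤-trans (ℕP.m⊓n≤m y _) y≤k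

  minOr-mono : (F : ℕ → ℕ) → (∀ {a b} → a ≤ b → F a ≤ F b) → ∀ x xs → foldr _⊓_ (F x) (map F xs) ≡ F (foldr _⊓_ x xs)
  minOr-mono F F-mono x []       = refl
  minOr-mono F F-mono x (y ∷ ys) = trans (cong (F y ⊓_) (minOr-mono F F-mono x ys)) (sym (⊓-mono y _))
    where
    ⊓-mono : ∀ a b → F (a ⊓ b) ≡ F a ⊓ F b
    ⊓-mono a b with ℕP.≤-total a b
    ... | inj₁ a≤b = trans (cong F (ℕP.m≤n⇒m⊓n≡m a≤b)) (sym (ℕP.m≤n⇒m⊓n≡m (F-mono a≤b)))
    ... | inj₂ b≤a = trans (cong F (ℕP.m≥n⇒m⊓n≡n b≤a)) (sym (ℕP.m≥n⇒m⊓n≡n (F-mono b≤a)))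

  minOr-gaps : (G : ℕ → ℕ) → (∀ {a b} → a ≤ b → G a ≤ G b) → G 0 ≡ 0 → (v : ℕ) (L : List ℕ) → All (_≤ v) L →
    minOr (map (λ u → G v ∸ G u) L) (G v) ≡ G v ∸ G (v ∸ minOr (map (v ∸_) L) v)
  minOr-gaps G G-mono G0 v L ≤v = trans (cong (λ z → minOr z (G v)) via-gaps) (apply (map (v ∸_) L))
    where
    F : ℕ → ℕ
    F δ = G v ∸ G (v ∸ δ)
    F-mono : ∀ {a b} → a ≤ b → F a ≤ F b
    F-mono a≤b = ℕP.∸-monoʳ-≤ (G v) (G-mono (ℕP.∸-monoʳ-≤ v a≤b))
    via-gaps : map (λ u → G v ∸ G u) L ≡ map F (map (v ∸_) L)
    via-gaps = go L ≤v
      where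
      go : (L : List ℕ) → All (_≤ v) L → map (λ u → G v ∸ G u) L ≡ map F (map (v ∸_) L)
      go []      []          = refl
      go (u ∷ L) (u≤v ∷ ≤v') = cong₂ _∷_ (cong (λ z → G v ∸ G z) (sym (ℕP.m∸[m∸n]≡n u≤v))) (go L ≤v')
    apply : (D : List ℕ) → minOr (map F D) (G v) ≡ F (minOr D v)
    apply []       = sym (trans (cong (λ z → G v ∸ G z) (ℕP.n∸n≡0 v)) (cong (G v ∸_) G0))
    apply (δ ∷ D) = minOr-mono F F-mono δ D

  d-minOr : {m : ℕ} (R : Rel (Fin m) 0ℓ) (R? : Decidable R) (σ : Fin m → Fin m) (i : Fin m) →
    d R R? σ i ≡ minOr (map (λ j → val R R? σ i ∸ val R R? σ j) (preds R R? i)) (val R R? σ i)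
  d-minOr R R? σ i with map (λ j → val R R? σ i ∸ val R R? σ j) (preds R R? i)
  ... | []     = refl
  ... | x ∷ xs = refl

  qlbTerm-resp : {m : ℕ} (R : Rel (Fin m) 0ℓ) (R? : Decidable R) → Extensional (qlbTerm R R?)
  qlbTerm-resp {m} R R? σ σ' eq = ∑-cong (allFin m) (λ i → cong (λ z → H (z ∸ 1)) (d-resp i))
    where
    d-resp : ∀ i → d R R? σ i ≡ d R R? σ' i
    d-resp i = trans (d-minOr R R? σ i) (trans (cong₂ minOr
      (ListP.map-cong (λ j → cong₂ (λ u v → suc (toℕ u) ∸ suc (toℕ v)) (eq i) (eq j)) (preds R R? i))
      (cong (λ u → suc (toℕ u)) (eq i))) (sym (d-minOr R R? σ' i)))

  module _ {m : ℕ} (R : Rel (Fin m) 0ℓ) (R? : Decidable R) (p : Fin m → Fin m)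
           (p-inj : Injective p) (p-mono : Monotone R R? p) where

    preds-below : ∀ a → All (λ j → val R R? p j < val R R? p a) (preds R R? a)
    preds-below a = All.map (λ {j} → below j) (all-filter (λ j → not (does (j ≟ a)) ∧ does (R? j a) Bool.≟ true) (allFin m))
      where
      below : ∀ j → not (does (j ≟ a)) ∧ does (R? j a) ≡ true → val R R? p j < val R R? p a
      below j e = s≤s (ℕP.≤∧≢⇒< (p-mono j a (from-does (R? j a) (∧-true⁻ʳ {not (does (j ≟ a))} e)))
                                (λ pj≡pa → from-not-does (j ≟ a) (∧-true⁻ˡ e) (p-inj j a (FinP.toℕ-injective pj≡pa))))

    d-form : ∀ a → d R R? p a ≡ minOr (map (val R R? p a ∸_) (map (val R R? p) (preds R R? a))) (val R R? p a)
    d-form a = trans (d-minOr R R? p a) (cong (λ L → minOr L (val R R? p a)) (ListP.map-∘ (preds R R? a)))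

    d≥1 : ∀ a → 1 ≤ d R R? p a
    d≥1 a = subst (1 ≤_) (sym (d-form a)) (minOr-glb _ (val R R? p a) 1 (s≤s z≤n)
      (AllP.map⁺ (AllP.map⁺ (All.map (λ vpj<vpa → ℕP.m<n⇒0<n∸m vpj<vpa) (preds-below a)))))

    d≤val : ∀ a → d R R? p a ≤ val R R? p a
    d≤val a = subst (_≤ val R R? p a) (sym (d-form a)) (minOr-≤ _ (val R R? p a) (val R R? p a) ℕP.≤-refl
      (AllP.map⁺ (AllP.map⁺ (All.map (λ {j} _ → ℕP.m∸n≤m (val R R? p a) (val R R? p j)) (preds-below a)))))

    minOr-G-gaps : (G : ℕ → ℕ) → (∀ {x y} → x ≤ y → G x ≤ G y) → G 0 ≡ 0 → ∀ a →
      minOr (map (λ j → G (val R R? p a) ∸ G (val R R? p j)) (preds R R? a)) (G (val R R? p a)) ≡ G (val R R? p a) ∸ G (val R R? p a ∸ d R R? p a)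
    minOr-G-gaps G G-mono G0 a = begin
        minOr (map (λ j → G (val R R? p a) ∸ G (val R R? p j)) (preds R R? a)) (G (val R R? p a))
          ≡⟨ cong (λ L → minOr L (G (val R R? p a))) (ListP.map-∘ (preds R R? a)) ⟩
        minOr (map (λ u → G (val R R? p a) ∸ G u) (map (val R R? p) (preds R R? a))) (G (val R R? p a))
          ≡⟨ minOr-gaps G G-mono G0 (val R R? p a) _ (AllP.map⁺ (All.map ℕP.<⇒≤ (preds-below a))) ⟩
        G (val R R? p a) ∸ G (val R R? p a ∸ minOr (map (val R R? p a ∸_) (map (val R R? p) (preds R R? a))) (val R R? p a))
          ≡⟨ cong (λ z → G (val R R? p a) ∸ G (val R R? p a ∸ z)) (sym (d-form a)) ⟩
        G (val R R? p a) ∸ G (val R R? p a ∸ d R R? p a) ∎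
      where open ≡-Reasoning

module Merge {n₁ n₂ : ℕ} (P : Rel (Fin n₁) 0ℓ) (Q : Rel (Fin n₂) 0ℓ) (P? : Decidable P) (Q? : Decidable Q) where

  open BooleanTests
  open LinearExtensions
  open Shuffles
  open PredecessorGaps
  open import Defs
  open import Data.Nat as ℕ using (ℕ; suc; _<_; _≤_; _<?_; _∸_)
  import Data.Nat.Properties as ℕP
  open import Data.Fin using (Fin; toℕ; _≟_; fromℕ<; _↑ˡ_; _↑ʳ_; splitAt; join)
  import Data.Fin.Properties as FinP
  open import Data.List using (map; _++_; allFin)
  import Data.List.Properties as ListP
  open import Data.Bool using (Bool; true; false; if_then_else_; _∧_; not)
  import Data.Bool as Bool
  import Data.Bool.Properties as BoolP
  open import Data.Bool.ListAction using (any)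
  open import Data.Product using (Σ; _,_; proj₁; proj₂)
  open import Data.Sum using (_⊎_; inj₁; inj₂)
  open import Relation.Nullary using (yes; no; does; ¬_)
  open import Relation.Nullary.Decidable using (dec-true; dec-false; does-⇔)
  open import Relation.Binary.PropositionalEquality
  open import Data.Empty using (⊥-elim)
  open import Function using (mk⇔)

  -- v as an element of Fin k when v < k (and the default w otherwise).
  clamp : {k : ℕ} → Fin k → ℕ → Fin k
  clamp {k} w v with v <? k
  ... | yes v<k = fromℕ< v<k
  ... | no _    = w

  toℕ-clamp : {k : ℕ} (w : Fin k) (v : ℕ) → v < k → toℕ (clamp w v) ≡ v
  toℕ-clamp {k} w v v<k with v <? k
  ... | yes v<k' = FinP.toℕ-fromℕ< v<k'
  ... | no v≮k   = ⊥-elim (v≮k v<k)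

  n : ℕ
  n = n₁ ℕ.+ n₂

  inL : Fin n₁ → Fin n
  inL a = a ↑ˡ n₂

  inR : Fin n₂ → Fin n
  inR b = n₁ ↑ʳ b

  view : (i : Fin n) → (Σ (Fin n₁) λ a → i ≡ inL a) ⊎ (Σ (Fin n₂) λ b → i ≡ inR b)
  view i with splitAt n₁ i in e
  ... | inj₁ a = inj₁ (a , trans (sym (FinP.join-splitAt n₁ n₂ i)) (cong (join n₁ n₂) e))
  ... | inj₂ b = inj₂ (b , trans (sym (FinP.join-splitAt n₁ n₂ i)) (cong (join n₁ n₂) e))

  inL≢inR : ∀ a b → inL a ≢ inR b
  inL≢inR a b e = ℕP.<-irrefl (cong toℕ e)
    (subst₂ _<_ (sym (FinP.toℕ-↑ˡ a n₂)) (sym (FinP.toℕ-↑ʳ n₁ b)) (ℕP.<-≤-trans (FinP.toℕ<n a) (ℕP.m≤m+n n₁ (toℕ b))))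

  ⊕-left⁻ : ∀ {a a'} → (P ⊕ Q) (inL a) (inL a') → P a a'
  ⊕-left⁻ {a} {a'} r with subst₂ (SumRel P Q) (FinP.splitAt-↑ˡ n₁ a n₂) (FinP.splitAt-↑ˡ n₁ a' n₂) r
  ... | left p = p

  ⊕-left⁺ : ∀ {a a'} → P a a' → (P ⊕ Q) (inL a) (inL a')
  ⊕-left⁺ {a} {a'} p = subst₂ (SumRel P Q) (sym (FinP.splitAt-↑ˡ n₁ a n₂)) (sym (FinP.splitAt-↑ˡ n₁ a' n₂)) (left p)

  ⊕-right⁻ : ∀ {b b'} → (P ⊕ Q) (inR b) (inR b') → Q b b'
  ⊕-right⁻ {b} {b'} r with subst₂ (SumRel P Q) (FinP.splitAt-↑ʳ n₁ n₂ b) (FinP.splitAt-↑ʳ n₁ n₂ b') r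
  ... | right q = q

  ⊕-right⁺ : ∀ {b b'} → Q b b' → (P ⊕ Q) (inR b) (inR b')
  ⊕-right⁺ {b} {b'} q = subst₂ (SumRel P Q) (sym (FinP.splitAt-↑ʳ n₁ n₂ b)) (sym (FinP.splitAt-↑ʳ n₁ n₂ b')) (right q)

  ⊕-left-right : ∀ {a b} → ¬ (P ⊕ Q) (inL a) (inR b)
  ⊕-left-right {a} {b} r with subst₂ (SumRel P Q) (FinP.splitAt-↑ˡ n₁ a n₂) (FinP.splitAt-↑ʳ n₁ n₂ b) r
  ... | ()

  ⊕-right-left : ∀ {a b} → ¬ (P ⊕ Q) (inR b) (inL a)
  ⊕-right-left {a} {b} r with subst₂ (SumRel P Q) (FinP.splitAt-↑ʳ n₁ n₂ b) (FinP.splitAt-↑ˡ n₁ a n₂) r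
  ... | ()

  preds-split : ∀ i (b₁ : Fin n₁ → Bool) (b₂ : Fin n₂ → Bool) →
    (∀ a → not (does (inL a ≟ i)) ∧ does (⊕-dec P? Q? (inL a) i) ≡ b₁ a) →
    (∀ b → not (does (inR b ≟ i)) ∧ does (⊕-dec P? Q? (inR b) i) ≡ b₂ b) →
    preds (P ⊕ Q) (⊕-dec P? Q?) i ≡ map inL (filterᵇ b₁ (allFin n₁)) ++ map inR (filterᵇ b₂ (allFin n₂))
  preds-split i b₁ b₂ on-inL on-inR = begin
      filterᵇ test (allFin n)
        ≡⟨ cong (filterᵇ test) (allFin-+ n₁ n₂) ⟩
      filterᵇ test (map inL (allFin n₁) ++ map inR (allFin n₂))
        ≡⟨ ListP.filter-++ (λ j → test j Bool.≟ true) (map inL (allFin n₁)) (map inR (allFin n₂)) ⟩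
      filterᵇ test (map inL (allFin n₁)) ++ filterᵇ test (map inR (allFin n₂))
        ≡⟨ cong₂ _++_ (trans (filterᵇ-map test inL (allFin n₁)) (cong (map inL) (filterᵇ-cong on-inL (allFin n₁))))
                      (trans (filterᵇ-map test inR (allFin n₂)) (cong (map inR) (filterᵇ-cong on-inR (allFin n₂)))) ⟩
      map inL (filterᵇ b₁ (allFin n₁)) ++ map inR (filterᵇ b₂ (allFin n₂)) ∎
    where
    open ≡-Reasoning
    test : Fin n → Bool
    test j = not (does (j ≟ i)) ∧ does (⊕-dec P? Q? j i)

  preds-inL : ∀ a → preds (P ⊕ Q) (⊕-dec P? Q?) (inL a) ≡ map inL (preds P P? a)
  preds-inL a = trans (preds-split (inL a) (λ a' → not (does (a' ≟ a)) ∧ does (P? a' a)) (λ _ → false) on-inL on-inR)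
    (trans (cong (map inL (preds P P? a) ++_) (cong (map inR) (filterᵇ-false (allFin n₂)))) (ListP.++-identityʳ _))
    where
    on-inL : ∀ a' → not (does (inL a' ≟ inL a)) ∧ does (⊕-dec P? Q? (inL a') (inL a)) ≡ not (does (a' ≟ a)) ∧ does (P? a' a)
    on-inL a' = cong₂ (λ u v → not u ∧ v)
      (does-⇔ (mk⇔ (FinP.↑ˡ-injective n₂ a' a) (cong inL)) (inL a' ≟ inL a) (a' ≟ a))
      (does-⇔ (mk⇔ ⊕-left⁻ ⊕-left⁺) (⊕-dec P? Q? (inL a') (inL a)) (P? a' a))
    on-inR : ∀ b → not (does (inR b ≟ inL a)) ∧ does (⊕-dec P? Q? (inR b) (inL a)) ≡ false
    on-inR b = trans (cong (not (does (inR b ≟ inL a)) ∧_) (dec-false (⊕-dec P? Q? (inR b) (inL a)) ⊕-right-left))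
                     (BoolP.∧-zeroʳ _)

  preds-inR : ∀ b → preds (P ⊕ Q) (⊕-dec P? Q?) (inR b) ≡ map inR (preds Q Q? b)
  preds-inR b = trans (preds-split (inR b) (λ _ → false) (λ b' → not (does (b' ≟ b)) ∧ does (Q? b' b)) on-inL on-inR)
    (cong (_++ map inR (preds Q Q? b)) (cong (map inL) (filterᵇ-false (allFin n₁))))
    where
    on-inL : ∀ a → not (does (inL a ≟ inR b)) ∧ does (⊕-dec P? Q? (inL a) (inR b)) ≡ false
    on-inL a = trans (cong (not (does (inL a ≟ inR b)) ∧_) (dec-false (⊕-dec P? Q? (inL a) (inR b)) ⊕-left-right))
                     (BoolP.∧-zeroʳ _)
    on-inR : ∀ b' → not (does (inR b' ≟ inR b)) ∧ does (⊕-dec P? Q? (inR b') (inR b)) ≡ not (does (b' ≟ b)) ∧ does (Q? b' b)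
    on-inR b' = cong₂ (λ u v → not u ∧ v)
      (does-⇔ (mk⇔ (FinP.↑ʳ-injective n₁ b' b) (cong inR)) (inR b' ≟ inR b) (b' ≟ b))
      (does-⇔ (mk⇔ ⊕-right⁻ ⊕-right⁺) (⊕-dec P? Q? (inR b') (inR b)) (Q? b' b))

  merge : (Fin n₁ → Fin n₁) → (Fin n₂ → Fin n₂) → (Fin n → Colour) → Fin n → Fin n
  merge p q s i = place (splitAt n₁ i)
    where
    place : Fin n₁ ⊎ Fin n₂ → Fin n
    place (inj₁ a) = clamp i (pos c₁ s (toℕ (p a)))
    place (inj₂ b) = clamp i (pos c₂ s (toℕ (q b)))

  merge-inL : ∀ p q s a → merge p q s (inL a) ≡ clamp (inL a) (pos c₁ s (toℕ (p a)))
  merge-inL p q s a rewrite FinP.splitAt-↑ˡ n₁ a n₂ = refl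

  merge-inR : ∀ p q s b → merge p q s (inR b) ≡ clamp (inR b) (pos c₂ s (toℕ (q b)))
  merge-inR p q s b rewrite FinP.splitAt-↑ʳ n₁ n₂ b = refl

  merge-resp : ∀ {p p' q q' s s'} → p ≗ p' → q ≗ q' → s ≗ s' → merge p q s ≗ merge p' q' s'
  merge-resp {p' = p'} {q' = q'} {s = s} ep eq es i with splitAt n₁ i
  ... | inj₁ a = cong (clamp i) (trans (cong (pos c₁ s) (cong toℕ (ep a))) (pos-resp c₁ es (toℕ (p' a))))
  ... | inj₂ b = cong (clamp i) (trans (cong (pos c₂ s) (cong toℕ (eq b))) (pos-resp c₂ es (toℕ (q' b))))

  -- The inverse: a position gets colour c₁ iff x places an element of P there,
  -- and part₁ x, part₂ x are the relative orders of P and Q within x.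
  colours : (Fin n → Fin n) → Fin n → Colour
  colours x p = if any (λ a → does (x (inL a) ≟ p)) (allFin n₁) then c₁ else c₂

  part₁ : (Fin n → Fin n) → Fin n₁ → Fin n₁
  part₁ x a = clamp a (rankAt c₁ (colours x) (toℕ (x (inL a))))

  part₂ : (Fin n → Fin n) → Fin n₂ → Fin n₂
  part₂ x b = clamp b (rankAt c₂ (colours x) (toℕ (x (inR b))))

  colours-resp : ∀ {x x'} → x ≗ x' → colours x ≗ colours x'
  colours-resp eq p = cong (λ z → if z then c₁ else c₂)
    (any-cong _ _ (allFin n₁) (λ a → cong (λ z → does (z ≟ p)) (eq (inL a))))

  part₁-resp : ∀ {x x'} → x ≗ x' → part₁ x ≗ part₁ x'
  part₁-resp {x} {x'} eq a = cong (clamp a) (trans (cong (rankAt c₁ (colours x)) (cong toℕ (eq (inL a))))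
    (rankAt-resp c₁ (colours-resp eq) (toℕ (x' (inL a)))))

  part₂-resp : ∀ {x x'} → x ≗ x' → part₂ x ≗ part₂ x'
  part₂-resp {x} {x'} eq b = cong (clamp b) (trans (cong (rankAt c₂ (colours x)) (cong toℕ (eq (inR b))))
    (rankAt-resp c₂ (colours-resp eq) (toℕ (x' (inR b)))))

  le-sum-eq : ∀ {a b x y : ℕ} → a ≤ x → b ≤ y → x ℕ.+ y ≡ a ℕ.+ b → x ≡ a
  le-sum-eq ax by e with ℕP.m≤n⇒m<n∨m≡n ax
  ... | inj₂ eq = sym eq
  ... | inj₁ lt = ⊥-elim (ℕP.<-irrefl (sym e) (ℕP.+-mono-<-≤ lt by))

  occ₂≡n₂ : (s : Fin n → Colour) → occ c₁ s ≡ n₁ → occ c₂ s ≡ n₂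
  occ₂≡n₂ s e = ℕP.+-cancelˡ-≡ n₁ _ _ (trans (cong (ℕ._+ occ c₂ s) (sym e)) (occ-c₁+c₂ s))

  module Split (x : Fin n → Fin n) (x-inj : Injective x) (x-mono : Monotone (P ⊕ Q) (⊕-dec P? Q?) x) where

    s : Fin n → Colour
    s = colours x

    colour-inL : ∀ a → s (x (inL a)) == c₁ ≡ true
    colour-inL a rewrite any-allFin⁺ n₁ (λ a' → does (x (inL a') ≟ x (inL a))) a (dec-true (x (inL a) ≟ x (inL a)) refl) = refl

    colour-inR : ∀ b → s (x (inR b)) == c₂ ≡ true
    colour-inR b rewrite any-allFin-false n₁ (λ a → does (x (inL a) ≟ x (inR b)))
                           (λ a → dec-false (x (inL a) ≟ x (inR b)) (λ e → inL≢inR a b (x-inj _ _ e))) = refl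

    rank₁ : Fin n₁ → ℕ
    rank₁ a = rankAt c₁ s (toℕ (x (inL a)))

    rank₂ : Fin n₂ → ℕ
    rank₂ b = rankAt c₂ s (toℕ (x (inR b)))

    pos-rank₁ : ∀ a → pos c₁ s (rank₁ a) ≡ toℕ (x (inL a))
    pos-rank₁ a = pos-rankAt c₁ s (x (inL a)) (colour-inL a)

    pos-rank₂ : ∀ b → pos c₂ s (rank₂ b) ≡ toℕ (x (inR b))
    pos-rank₂ b = pos-rankAt c₂ s (x (inR b)) (colour-inR b)

    rank₁-injective : ∀ a a' → rank₁ a ≡ rank₁ a' → a ≡ a'
    rank₁-injective a a' e = FinP.↑ˡ-injective n₂ a a' (x-inj _ _ (FinP.toℕ-injective
      (trans (sym (pos-rank₁ a)) (trans (cong (pos c₁ s) e) (pos-rank₁ a')))))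

    rank₂-injective : ∀ b b' → rank₂ b ≡ rank₂ b' → b ≡ b'
    rank₂-injective b b' e = FinP.↑ʳ-injective n₁ b b' (x-inj _ _ (FinP.toℕ-injective
      (trans (sym (pos-rank₂ b)) (trans (cong (pos c₂ s) e) (pos-rank₂ b')))))

    -- The colour word has exactly n₁ letters c₁: at least n₁ and at least n₂ letters of each colour.
    occ₁ : occ c₁ s ≡ n₁
    occ₁ = le-sum-eq (atLeast (rankAt-bound c₁ s _ ∘ colour-inL) rank₁-injective)
                     (atLeast (rankAt-bound c₂ s _ ∘ colour-inR) rank₂-injective) (occ-c₁+c₂ s)
      where
      open import Function using (_∘_)
      atLeast : ∀ {m k} {f : Fin m → ℕ} → (∀ a → f a < k) → (∀ a a' → f a ≡ f a' → a ≡ a') → m ≤ k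
      atLeast {f = f} bound inj = FinP.injective⇒≤ {f = λ a → fromℕ< (bound a)}
        (λ {a} {a'} e → inj a a' (trans (sym (FinP.toℕ-fromℕ< (bound a))) (trans (cong toℕ e) (FinP.toℕ-fromℕ< (bound a')))))

    toℕ-part₁ : ∀ a → toℕ (part₁ x a) ≡ rank₁ a
    toℕ-part₁ a = toℕ-clamp a (rank₁ a) (subst (rank₁ a <_) occ₁ (rankAt-bound c₁ s _ (colour-inL a)))

    toℕ-part₂ : ∀ b → toℕ (part₂ x b) ≡ rank₂ b
    toℕ-part₂ b = toℕ-clamp b (rank₂ b) (subst (rank₂ b <_) (occ₂≡n₂ s occ₁) (rankAt-bound c₂ s _ (colour-inR b)))

    part₁-linExt : isLinExt P P? (part₁ x) ≡ true
    part₁-linExt = linExt⇒isLinExt P P? (part₁ x)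
      (λ a a' e → rank₁-injective a a' (trans (sym (toℕ-part₁ a)) (trans (cong toℕ e) (toℕ-part₁ a'))))
      (λ a a' r → subst₂ _≤_ (sym (toℕ-part₁ a)) (sym (toℕ-part₁ a')) (rankAt-mono c₁ s (x-mono _ _ (⊕-left⁺ r))))

    part₂-linExt : isLinExt Q Q? (part₂ x) ≡ true
    part₂-linExt = linExt⇒isLinExt Q Q? (part₂ x)
      (λ b b' e → rank₂-injective b b' (trans (sym (toℕ-part₂ b)) (trans (cong toℕ e) (toℕ-part₂ b'))))
      (λ b b' r → subst₂ _≤_ (sym (toℕ-part₂ b)) (sym (toℕ-part₂ b')) (rankAt-mono c₂ s (x-mono _ _ (⊕-right⁺ r))))

    merge-split : merge (part₁ x) (part₂ x) s ≗ x
    merge-split i with view i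
    ... | inj₁ (a , refl) = FinP.toℕ-injective (trans (cong toℕ (merge-inL (part₁ x) (part₂ x) s a))
            (trans (toℕ-clamp (inL a) _ (subst (_< n) (sym placed) (FinP.toℕ<n (x (inL a))))) placed))
      where
      placed : pos c₁ s (toℕ (part₁ x a)) ≡ toℕ (x (inL a))
      placed = trans (cong (pos c₁ s) (toℕ-part₁ a)) (pos-rank₁ a)
    ... | inj₂ (b , refl) = FinP.toℕ-injective (trans (cong toℕ (merge-inR (part₁ x) (part₂ x) s b))
            (trans (toℕ-clamp (inR b) _ (subst (_< n) (sym placed) (FinP.toℕ<n (x (inR b))))) placed))
      where
      placed : pos c₂ s (toℕ (part₂ x b)) ≡ toℕ (x (inR b))
      placed = trans (cong (pos c₂ s) (toℕ-part₂ b)) (pos-rank₂ b)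

  module Merged (p : Fin n₁ → Fin n₁) (q : Fin n₂ → Fin n₂) (s : Fin n → Colour)
                (p∈Δ : isLinExt P P? p ≡ true) (q∈Δ : isLinExt Q Q? q ≡ true) (occ₁ : occ c₁ s ≡ n₁) where

    p-inj  = isLinExt⇒injective P P? p p∈Δ
    q-inj  = isLinExt⇒injective Q Q? q q∈Δ
    p-mono = isLinExt⇒monotone P P? p p∈Δ
    q-mono = isLinExt⇒monotone Q Q? q q∈Δ

    y : Fin n → Fin n
    y = merge p q s

    p<occ : ∀ a → toℕ (p a) < occ c₁ s
    p<occ a = subst (toℕ (p a) <_) (sym occ₁) (FinP.toℕ<n (p a))

    q<occ : ∀ b → toℕ (q b) < occ c₂ s
    q<occ b = subst (toℕ (q b) <_) (sym (occ₂≡n₂ s occ₁)) (FinP.toℕ<n (q b))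

    toℕ-y-inL : ∀ a → toℕ (y (inL a)) ≡ pos c₁ s (toℕ (p a))
    toℕ-y-inL a = trans (cong toℕ (merge-inL p q s a)) (toℕ-clamp (inL a) _ (pos-bound c₁ s _ (p<occ a)))

    toℕ-y-inR : ∀ b → toℕ (y (inR b)) ≡ pos c₂ s (toℕ (q b))
    toℕ-y-inR b = trans (cong toℕ (merge-inR p q s b)) (toℕ-clamp (inR b) _ (pos-bound c₂ s _ (q<occ b)))

    colour-inL : ∀ a → s (y (inL a)) == c₁ ≡ true
    colour-inL a = pos-colour c₁ s (toℕ (p a)) (p<occ a) (y (inL a)) (toℕ-y-inL a)

    colour-inR : ∀ b → s (y (inR b)) == c₂ ≡ true
    colour-inR b = pos-colour c₂ s (toℕ (q b)) (q<occ b) (y (inR b)) (toℕ-y-inR b)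

    y-inL≢y-inR : ∀ a b → y (inL a) ≢ y (inR b)
    y-inL≢y-inR a b e = true≢false (trans (sym (colour-inL a))
      (trans (cong (λ z → s z == c₁) e) (c₂⇒not-c₁ (s (y (inR b))) (colour-inR b))))

    y-injective : Injective y
    y-injective i j e with view i | view j
    ... | inj₁ (a , refl) | inj₁ (a' , refl) = cong inL (p-inj a a' (FinP.toℕ-injective
            (trans (sym (rankAt-pos c₁ s _ (p<occ a)))
            (trans (cong (rankAt c₁ s) (trans (sym (toℕ-y-inL a)) (trans (cong toℕ e) (toℕ-y-inL a'))))
                   (rankAt-pos c₁ s _ (p<occ a'))))))
    ... | inj₂ (b , refl) | inj₂ (b' , refl) = cong inR (q-inj b b' (FinP.toℕ-injective
            (trans (sym (rankAt-pos c₂ s _ (q<occ b)))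
            (trans (cong (rankAt c₂ s) (trans (sym (toℕ-y-inR b)) (trans (cong toℕ e) (toℕ-y-inR b'))))
                   (rankAt-pos c₂ s _ (q<occ b'))))))
    ... | inj₁ (a , refl) | inj₂ (b , refl) = ⊥-elim (y-inL≢y-inR a b e)
    ... | inj₂ (b , refl) | inj₁ (a , refl) = ⊥-elim (y-inL≢y-inR a b (sym e))

    y-monotone : Monotone (P ⊕ Q) (⊕-dec P? Q?) y
    y-monotone i j r with view i | view j
    ... | inj₁ (a , refl) | inj₁ (a' , refl) =
            subst₂ _≤_ (sym (toℕ-y-inL a)) (sym (toℕ-y-inL a')) (pos-mono c₁ s (p-mono a a' (⊕-left⁻ r)))
    ... | inj₂ (b , refl) | inj₂ (b' , refl) =
            subst₂ _≤_ (sym (toℕ-y-inR b)) (sym (toℕ-y-inR b')) (pos-mono c₂ s (q-mono b b' (⊕-right⁻ r)))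
    ... | inj₁ (a , refl) | inj₂ (b , refl) = ⊥-elim (⊕-left-right r)
    ... | inj₂ (b , refl) | inj₁ (a , refl) = ⊥-elim (⊕-right-left r)

    y∈Δ : isLinExt (P ⊕ Q) (⊕-dec P? Q?) y ≡ true
    y∈Δ = linExt⇒isLinExt (P ⊕ Q) (⊕-dec P? Q?) y y-injective y-monotone

    colours-y : colours y ≗ s
    colours-y i with s i == c₁ in e
    ... | true = trans (cong (λ b → if b then c₁ else c₂) (any-allFin⁺ n₁ _ a (dec-true (y (inL a) ≟ i) ya≡i)))
                       (sym (==-sound (s i) c₁ e))
      where
      r = rankAt c₁ s (toℕ i)
      r<n₁ : r < n₁
      r<n₁ = subst (r <_) occ₁ (rankAt-bound c₁ s i e)
      a = proj₁ (injective⇒onto p p-inj (fromℕ< r<n₁))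
      pa≡r : toℕ (p a) ≡ r
      pa≡r = trans (cong toℕ (proj₂ (injective⇒onto p p-inj (fromℕ< r<n₁)))) (FinP.toℕ-fromℕ< r<n₁)
      ya≡i : y (inL a) ≡ i
      ya≡i = FinP.toℕ-injective (trans (toℕ-y-inL a) (trans (cong (pos c₁ s) pa≡r) (pos-rankAt c₁ s i e)))
    ... | false = trans (cong (λ b → if b then c₁ else c₂) (any-allFin-false n₁ _
                          (λ a → dec-false (y (inL a) ≟ i) (λ ya≡i → true≢false
                            (trans (sym (colour-inL a)) (trans (cong (λ z → s z == c₁) ya≡i) e))))))
                        (sym (==-sound (s i) c₂ (c₁-or-c₂ (s i) e)))

    part₁-y : part₁ y ≗ p
    part₁-y a = FinP.toℕ-injective (trans (toℕ-clamp a _ (subst (_< n₁) (sym e) (FinP.toℕ<n (p a)))) e)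
      where
      e : rankAt c₁ (colours y) (toℕ (y (inL a))) ≡ toℕ (p a)
      e = trans (rankAt-resp c₁ colours-y _) (trans (cong (rankAt c₁ s) (toℕ-y-inL a)) (rankAt-pos c₁ s _ (p<occ a)))

    part₂-y : part₂ y ≗ q
    part₂-y b = FinP.toℕ-injective (trans (toℕ-clamp b _ (subst (_< n₂) (sym e) (FinP.toℕ<n (q b)))) e)
      where
      e : rankAt c₂ (colours y) (toℕ (y (inR b))) ≡ toℕ (q b)
      e = trans (rankAt-resp c₂ colours-y _) (trans (cong (rankAt c₂ s) (toℕ-y-inR b)) (rankAt-pos c₂ s _ (q<occ b)))

    d-inL : ∀ a → d (P ⊕ Q) (⊕-dec P? Q?) y (inL a) ≡ gapEnd c₁ s (val P P? p a) ∸ gapEnd c₁ s (val P P? p a ∸ d P P? p a)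
    d-inL a = begin
        d (P ⊕ Q) (⊕-dec P? Q?) y (inL a)
          ≡⟨ d-minOr (P ⊕ Q) (⊕-dec P? Q?) y (inL a) ⟩
        minOr (map (λ j → val⊕ (inL a) ∸ val⊕ j) (preds (P ⊕ Q) (⊕-dec P? Q?) (inL a))) (val⊕ (inL a))
          ≡⟨ cong₂ minOr (trans (cong (map (λ j → val⊕ (inL a) ∸ val⊕ j)) (preds-inL a)) (sym (ListP.map-∘ (preds P P? a))))
                         (val⊕-inL a) ⟩
        minOr (map (λ a' → val⊕ (inL a) ∸ val⊕ (inL a')) (preds P P? a)) (G (val P P? p a))
          ≡⟨ cong (λ L → minOr L (G (val P P? p a))) (ListP.map-cong (λ a' → cong₂ _∸_ (val⊕-inL a) (val⊕-inL a')) (preds P P? a)) ⟩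
        minOr (map (λ a' → G (val P P? p a) ∸ G (val P P? p a')) (preds P P? a)) (G (val P P? p a))
          ≡⟨ minOr-G-gaps P P? p p-inj p-mono G (gapEnd-mono c₁ s) refl a ⟩
        G (val P P? p a) ∸ G (val P P? p a ∸ d P P? p a) ∎
      where
      open ≡-Reasoning
      G = gapEnd c₁ s
      val⊕ = val (P ⊕ Q) (⊕-dec P? Q?) y
      val⊕-inL : ∀ a → val⊕ (inL a) ≡ G (val P P? p a)
      val⊕-inL a = cong suc (toℕ-y-inL a)

    d-inR : ∀ b → d (P ⊕ Q) (⊕-dec P? Q?) y (inR b) ≡ gapEnd c₂ s (val Q Q? q b) ∸ gapEnd c₂ s (val Q Q? q b ∸ d Q Q? q b)
    d-inR b = begin
        d (P ⊕ Q) (⊕-dec P? Q?) y (inR b)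
          ≡⟨ d-minOr (P ⊕ Q) (⊕-dec P? Q?) y (inR b) ⟩
        minOr (map (λ j → val⊕ (inR b) ∸ val⊕ j) (preds (P ⊕ Q) (⊕-dec P? Q?) (inR b))) (val⊕ (inR b))
          ≡⟨ cong₂ minOr (trans (cong (map (λ j → val⊕ (inR b) ∸ val⊕ j)) (preds-inR b)) (sym (ListP.map-∘ (preds Q Q? b))))
                         (val⊕-inR b) ⟩
        minOr (map (λ b' → val⊕ (inR b) ∸ val⊕ (inR b')) (preds Q Q? b)) (G (val Q Q? q b))
          ≡⟨ cong (λ L → minOr L (G (val Q Q? q b))) (ListP.map-cong (λ b' → cong₂ _∸_ (val⊕-inR b) (val⊕-inR b')) (preds Q Q? b)) ⟩
        minOr (map (λ b' → G (val Q Q? q b) ∸ G (val Q Q? q b')) (preds Q Q? b)) (G (val Q Q? q b))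
          ≡⟨ minOr-G-gaps Q Q? q q-inj q-mono G (gapEnd-mono c₂ s) refl b ⟩
        G (val Q Q? q b) ∸ G (val Q Q? q b ∸ d Q Q? q b) ∎
      where
      open ≡-Reasoning
      G = gapEnd c₂ s
      val⊕ = val (P ⊕ Q) (⊕-dec P? Q?) y
      val⊕-inR : ∀ b → val⊕ (inR b) ≡ G (val Q Q? q b)
      val⊕-inR b = cong suc (toℕ-y-inR b)

module Reindexing {n₁ n₂ : ℕ} (P : Rel (Fin n₁) 0ℓ) (Q : Rel (Fin n₂) 0ℓ) (P? : Decidable P) (Q? : Decidable Q) where

  open FiniteSums
  open FunctionSums
  open BooleanTests
  open LinearExtensions
  open Shuffles
  open Merge P Q P? Q?
  open import Defs
  open import Data.Nat as ℕ using (ℕ)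
  open import Data.Rational using (ℚ; 1ℚ; _*_)
  import Data.Rational.Properties as ℚP
  open import Data.List using (List)
  open import Data.Bool using (Bool; true; _∧_)
  open import Relation.Binary.PropositionalEquality
  open import Data.Rational.Solver
  open +-*-Solver

  isTriple : (Fin n₁ → Fin n₁) → (Fin n₂ → Fin n₂) → (Fin n → Colour) → Bool
  isTriple p q s = isLinExt P P? p ∧ (isLinExt Q Q? q ∧ (occ c₁ s ℕ.≡ᵇ n₁))

  merge≡⇔split≡ : ∀ σ p q s →
    (merge p q s ≗ᵇ σ) ∧ isTriple p q s
      ≡ isLinExt (P ⊕ Q) (⊕-dec P? Q?) σ ∧ ((part₁ σ ≗ᵇ p) ∧ ((part₂ σ ≗ᵇ q) ∧ (colours σ ≗ᵇ s)))
  merge≡⇔split≡ σ p q s = bool-ext _ _ merged⇒split split⇒merged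
    where
    merged⇒split : (merge p q s ≗ᵇ σ) ∧ isTriple p q s ≡ true → _ ≡ true
    merged⇒split e = ∧-true⁺ (trans (sym (isLinExt-resp (P ⊕ Q) (⊕-dec P? Q?) _ _ y≗σ)) y∈Δ)
      (∧-true⁺ (≗ᵇ-complete _ _ (λ a → trans (sym (part₁-resp y≗σ a)) (part₁-y a)))
      (∧-true⁺ (≗ᵇ-complete _ _ (λ b → trans (sym (part₂-resp y≗σ b)) (part₂-y b)))
               (≗ᵇ-complete _ _ (λ i → trans (sym (colours-resp y≗σ i)) (colours-y i)))))
      where
      y≗σ = ≗ᵇ-sound _ _ (∧-true⁻ˡ e)
      triple = ∧-true⁻ʳ {merge p q s ≗ᵇ σ} e
      open Merged p q s (∧-true⁻ˡ triple) (∧-true⁻ˡ (∧-true⁻ʳ {isLinExt P P? p} triple))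
                  (≡ᵇ-sound _ _ (∧-true⁻ʳ {isLinExt Q Q? q} (∧-true⁻ʳ {isLinExt P P? p} triple)))
    split⇒merged : _ ≡ true → (merge p q s ≗ᵇ σ) ∧ isTriple p q s ≡ true
    split⇒merged e =
      ∧-true⁺ (≗ᵇ-complete _ _ (λ i → trans (merge-resp (λ a → sym (p≗ a)) (λ b → sym (q≗ b)) (λ i → sym (s≗ i)) i) (merge-split i)))
      (∧-true⁺ (trans (isLinExt-resp P P? _ _ (λ a → sym (p≗ a))) part₁-linExt)
      (∧-true⁺ (trans (isLinExt-resp Q Q? _ _ (λ b → sym (q≗ b))) part₂-linExt)
               (subst (λ k → (k ℕ.≡ᵇ n₁) ≡ true) (sym (trans (occ-resp c₁ (λ i → sym (s≗ i))) occ₁)) (≡ᵇ-refl n₁))))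
      where
      σ∈Δ = ∧-true⁻ˡ e
      parts = ∧-true⁻ʳ {isLinExt (P ⊕ Q) (⊕-dec P? Q?) σ} e
      p≗ = ≗ᵇ-sound _ _ (∧-true⁻ˡ parts)
      q≗ = ≗ᵇ-sound _ _ (∧-true⁻ˡ (∧-true⁻ʳ {part₁ σ ≗ᵇ p} parts))
      s≗ = ≗ᵇ-sound _ _ (∧-true⁻ʳ {part₂ σ ≗ᵇ q} (∧-true⁻ʳ {part₁ σ ≗ᵇ p} parts))
      open Split σ (isLinExt⇒injective (P ⊕ Q) (⊕-dec P? Q?) σ σ∈Δ) (isLinExt⇒monotone (P ⊕ Q) (⊕-dec P? Q?) σ σ∈Δ)

  ∑³ : ((Fin n₁ → Fin n₁) → (Fin n₂ → Fin n₂) → (Fin n → Colour) → ℚ) → ℚ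
  ∑³ F = ∑ (allFuns n₁ n₁) (λ p → ∑ (allFuns n₂ n₂) (λ q → ∑ (allFuns n 2) (λ s → F p q s)))

  ∑³-cong : ∀ {F G} → (∀ p q s → F p q s ≡ G p q s) → ∑³ F ≡ ∑³ G
  ∑³-cong eq = ∑-cong (allFuns n₁ n₁) (λ p → ∑-cong (allFuns n₂ n₂) (λ q → ∑-cong (allFuns n 2) (λ s → eq p q s)))

  ∑³-*ʳ : ∀ F c → ∑³ (λ p q s → F p q s * c) ≡ ∑³ F * c
  ∑³-*ʳ F c = trans (∑-cong (allFuns n₁ n₁) (λ p → trans (∑-cong (allFuns n₂ n₂) (λ q → ∑-*ʳ (allFuns n 2) c (F p q)))
                                                          (∑-*ʳ (allFuns n₂ n₂) c _)))
                    (∑-*ʳ (allFuns n₁ n₁) c _)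

  ∑-∑³ : {A : Set} (L : List A) (F : A → (Fin n₁ → Fin n₁) → (Fin n₂ → Fin n₂) → (Fin n → Colour) → ℚ) →
         ∑ L (λ σ → ∑³ (F σ)) ≡ ∑³ (λ p q s → ∑ L (λ σ → F σ p q s))
  ∑-∑³ L F = trans (∑-swap L (allFuns n₁ n₁) _) (∑-cong (allFuns n₁ n₁) (λ p →
    trans (∑-swap L (allFuns n₂ n₂) _) (∑-cong (allFuns n₂ n₂) (λ q → ∑-swap L (allFuns n 2) _))))

  δ-split : (Fin n → Fin n) → (Fin n₁ → Fin n₁) → (Fin n₂ → Fin n₂) → (Fin n → Colour) → ℚ
  δ-split σ p q s = δ (part₁ σ) p * (δ (part₂ σ) q * δ (colours σ) s)

  ∑³-δ-split : ∀ σ → ∑³ (δ-split σ) ≡ 1ℚ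
  ∑³-δ-split σ = begin
      ∑³ (δ-split σ)
        ≡⟨ ∑-cong (allFuns n₁ n₁) (λ p → trans (∑-cong (allFuns n₂ n₂) (λ q →
             trans (∑-*ˡ (allFuns n 2) (δ (part₁ σ) p) _) (cong (δ (part₁ σ) p *_)
             (trans (∑-*ˡ (allFuns n 2) (δ (part₂ σ) q) _) (cong (δ (part₂ σ) q *_) (∑-δ n 2 (colours σ)))))))
             (∑-*ˡ (allFuns n₂ n₂) (δ (part₁ σ) p) _)) ⟩
      ∑ (allFuns n₁ n₁) (λ p → δ (part₁ σ) p * ∑ (allFuns n₂ n₂) (λ q → δ (part₂ σ) q * 1ℚ))
        ≡⟨ ∑-cong (allFuns n₁ n₁) (λ p → cong (δ (part₁ σ) p *_) (∑-sift n₂ n₂ (part₂ σ) (λ _ → 1ℚ) (λ _ _ _ → refl))) ⟩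
      ∑ (allFuns n₁ n₁) (λ p → δ (part₁ σ) p * 1ℚ)
        ≡⟨ ∑-sift n₁ n₁ (part₁ σ) (λ _ → 1ℚ) (λ _ _ _ → refl) ⟩
      1ℚ ∎
    where open ≡-Reasoning

  δ-merge : ∀ σ p q s → δ (merge p q s) σ * [ isTriple p q s ]ℚ ≡ [ isLinExt (P ⊕ Q) (⊕-dec P? Q?) σ ]ℚ * δ-split σ p q s
  δ-merge σ p q s = begin
      δ (merge p q s) σ * [ isTriple p q s ]ℚ
        ≡⟨ sym ([∧] (merge p q s ≗ᵇ σ) (isTriple p q s)) ⟩
      [ (merge p q s ≗ᵇ σ) ∧ isTriple p q s ]ℚ
        ≡⟨ cong [_]ℚ (merge≡⇔split≡ σ p q s) ⟩
      [ isLinExt (P ⊕ Q) (⊕-dec P? Q?) σ ∧ ((part₁ σ ≗ᵇ p) ∧ ((part₂ σ ≗ᵇ q) ∧ (colours σ ≗ᵇ s))) ]ℚ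
        ≡⟨ trans ([∧] (isLinExt (P ⊕ Q) (⊕-dec P? Q?) σ) _) (cong ([ isLinExt (P ⊕ Q) (⊕-dec P? Q?) σ ]ℚ *_)
             (trans ([∧] (part₁ σ ≗ᵇ p) _) (cong (δ (part₁ σ) p *_) ([∧] (part₂ σ ≗ᵇ q) (colours σ ≗ᵇ s))))) ⟩
      [ isLinExt (P ⊕ Q) (⊕-dec P? Q?) σ ]ℚ * δ-split σ p q s ∎
    where open ≡-Reasoning

  -- Inserting 1 = ∑³ (δ-split σ) spreads the summand [σ ∈ Δ(P ⊕ Q)] T σ over the triples.
  spread : (T : (Fin n → Fin n) → ℚ) (σ : Fin n → Fin n) →
    ∑³ (λ p q s → δ (merge p q s) σ * ([ isTriple p q s ]ℚ * T σ)) ≡ [ isLinExt (P ⊕ Q) (⊕-dec P? Q?) σ ]ℚ * T σ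
  spread T σ = begin
      ∑³ (λ p q s → δ (merge p q s) σ * ([ isTriple p q s ]ℚ * T σ))
        ≡⟨ ∑³-cong (λ p q s → trans (sym (ℚP.*-assoc (δ (merge p q s) σ) [ isTriple p q s ]ℚ (T σ)))
             (trans (cong (_* T σ) (δ-merge σ p q s))
                    (solve 3 (λ a d t → a :* d :* t := d :* (a :* t)) refl [ σ∈Δ ]ℚ (δ-split σ p q s) (T σ)))) ⟩
      ∑³ (λ p q s → δ-split σ p q s * ([ σ∈Δ ]ℚ * T σ))
        ≡⟨ trans (∑³-*ʳ (δ-split σ) _) (cong (_* ([ σ∈Δ ]ℚ * T σ)) (∑³-δ-split σ)) ⟩
      1ℚ * ([ σ∈Δ ]ℚ * T σ)
        ≡⟨ ℚP.*-identityˡ _ ⟩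
      [ σ∈Δ ]ℚ * T σ ∎
    where
    open ≡-Reasoning
    σ∈Δ = isLinExt (P ⊕ Q) (⊕-dec P? Q?) σ

  ∑-isTriple : (T : (Fin n → Fin n) → ℚ) (p : Fin n₁ → Fin n₁) (q : Fin n₂ → Fin n₂) →
    ∑ (allFuns n 2) (λ s → [ isTriple p q s ]ℚ * T (merge p q s))
      ≡ [ isLinExt P P? p ]ℚ * ([ isLinExt Q Q? q ]ℚ * ∑ (allFuns n 2) (λ s → W c₁ n₁ s * T (merge p q s)))
  ∑-isTriple T p q = begin
      ∑ (allFuns n 2) (λ s → [ isTriple p q s ]ℚ * T (merge p q s))
        ≡⟨ ∑-cong (allFuns n 2) (λ s → trans (cong (_* T (merge p q s)) (trans ([∧] (isLinExt P P? p) _) (cong (a *_) ([∧] (isLinExt Q Q? q) _))))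
             (solve 4 (λ a b w t → a :* (b :* w) :* t := a :* (b :* (w :* t))) refl a b (W c₁ n₁ s) (T (merge p q s)))) ⟩
      ∑ (allFuns n 2) (λ s → a * (b * (W c₁ n₁ s * T (merge p q s))))
        ≡⟨ trans (∑-*ˡ (allFuns n 2) a _) (cong (a *_) (∑-*ˡ (allFuns n 2) b _)) ⟩
      a * (b * ∑ (allFuns n 2) (λ s → W c₁ n₁ s * T (merge p q s))) ∎
    where
    open ≡-Reasoning
    a = [ isLinExt P P? p ]ℚ
    b = [ isLinExt Q Q? q ]ℚ

  ∑-Δ⊕ : (T : (Fin n → Fin n) → ℚ) → Extensional T →
    ∑ (Δ (P ⊕ Q) (⊕-dec P? Q?)) T ≡ ∑ (Δ P P?) (λ p → ∑ (Δ Q Q?) (λ q → ∑ (allFuns n 2) (λ s → W c₁ n₁ s * T (merge p q s))))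
  ∑-Δ⊕ T T-resp = begin
      ∑ (Δ (P ⊕ Q) (⊕-dec P? Q?)) T
        ≡⟨ ∑-Δ (P ⊕ Q) (⊕-dec P? Q?) T ⟩
      ∑ (allFuns n n) (λ σ → [ isLinExt (P ⊕ Q) (⊕-dec P? Q?) σ ]ℚ * T σ)
        ≡⟨ ∑-cong (allFuns n n) (λ σ → sym (spread T σ)) ⟩
      ∑ (allFuns n n) (λ σ → ∑³ (λ p q s → δ (merge p q s) σ * ([ isTriple p q s ]ℚ * T σ)))
        ≡⟨ ∑-∑³ (allFuns n n) _ ⟩
      ∑³ (λ p q s → ∑ (allFuns n n) (λ σ → δ (merge p q s) σ * ([ isTriple p q s ]ℚ * T σ)))
        ≡⟨ ∑³-cong (λ p q s → ∑-sift n n (merge p q s) _ (λ σ σ' eq → cong ([ isTriple p q s ]ℚ *_) (T-resp σ σ' eq))) ⟩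
      ∑³ (λ p q s → [ isTriple p q s ]ℚ * T (merge p q s))
        ≡⟨ ∑-cong (allFuns n₁ n₁) (λ p → trans (∑-cong (allFuns n₂ n₂) (∑-isTriple T p)) (∑-*ˡ (allFuns n₂ n₂) [ isLinExt P P? p ]ℚ _)) ⟩
      ∑ (allFuns n₁ n₁) (λ p → [ isLinExt P P? p ]ℚ * ∑ (allFuns n₂ n₂) (λ q → [ isLinExt Q Q? q ]ℚ * inner p q))
        ≡⟨ sym (trans (∑-Δ P P? _) (∑-cong (allFuns n₁ n₁) (λ p → cong ([ isLinExt P P? p ]ℚ *_) (∑-Δ Q Q? (inner p))))) ⟩
      ∑ (Δ P P?) (λ p → ∑ (Δ Q Q?) (inner p)) ∎
    where
    open ≡-Reasoning
    inner : (Fin n₁ → Fin n₁) → (Fin n₂ → Fin n₂) → ℚ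
    inner p q = ∑ (allFuns n 2) (λ s → W c₁ n₁ s * T (merge p q s))

module BlockSums where

  open FiniteSums
  open RationalArithmetic
  open LinearExtensions
  open Shuffles
  open GapSums
  open PredecessorGaps
  open import Defs
  open import Data.Nat as ℕ using (ℕ; _∸_)
  import Data.Nat.Properties as ℕP
  open import Data.Rational using (ℚ; _+_; _*_; _-_; -_)
  import Data.Rational.Properties as ℚP
  import Data.Fin.Properties as FinP
  open import Data.List using (allFin)
  open import Relation.Binary.PropositionalEquality

  -- One block of a merge: the elements of R on Fin k, in the order of a linear
  -- extension p, placed at the k letters c of a word s of length n.
  ∑-block : (n : ℕ) (c : Colour) {k : ℕ} (R : Rel (Fin k) 0ℓ) (R? : Decidable R) (p : Fin k → Fin k)
            (p-inj : Injective p) (p-mono : Monotone R R? p) →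
    ∑ (allFuns n 2) (λ s → W c k s * ∑ (allFin k) (λ a → H (gapEnd c s (val R R? p a) ∸ gapEnd c s (val R R? p a ∸ d R R? p a) ∸ 1)))
      ≡ ι (binom n k) * (qlbTerm R R? p + ι k * (H n - H k))
  ∑-block n c {k} R R? p p-inj p-mono = begin
      ∑ S (λ s → W c k s * ∑ (allFin k) (λ a → gapH s a))
        ≡⟨ ∑-cong S (λ s → sym (∑-*ˡ (allFin k) (W c k s) (gapH s))) ⟩
      ∑ S (λ s → ∑ (allFin k) (λ a → W c k s * gapH s a))
        ≡⟨ ∑-swap S (allFin k) _ ⟩
      ∑ (allFin k) (λ a → ∑ S (λ s → W c k s * gapH s a))
        ≡⟨ ∑-cong (allFin k) (λ a → trans (∑-H-gap n c k _ _ (gap<val a) (FinP.toℕ<n (p a)))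
             (cong (λ z → ι (binom n k) * (H (z ∸ 1) + H n - H k)) (ℕP.m∸[m∸n]≡n (d≤val R R? p p-inj p-mono a)))) ⟩
      ∑ (allFin k) (λ a → ι (binom n k) * (H (d R R? p a ∸ 1) + H n - H k))
        ≡⟨ ∑-cong (allFin k) (λ a → cong (ι (binom n k) *_) (ℚP.+-assoc (H (d R R? p a ∸ 1)) (H n) (- H k))) ⟩
      ∑ (allFin k) (λ a → ι (binom n k) * (H (d R R? p a ∸ 1) + (H n - H k)))
        ≡⟨ ∑-*ˡ (allFin k) (ι (binom n k)) _ ⟩
      ι (binom n k) * ∑ (allFin k) (λ a → H (d R R? p a ∸ 1) + (H n - H k))
        ≡⟨ cong (ι (binom n k) *_) (trans (∑-+ (allFin k) _ _) (cong (qlbTerm R R? p +_) (∑-const k (H n - H k)))) ⟩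
      ι (binom n k) * (qlbTerm R R? p + ι k * (H n - H k)) ∎
    where
    open ≡-Reasoning
    S = allFuns n 2
    gapH : (Fin n → Colour) → Fin k → ℚ
    gapH s a = H (gapEnd c s (val R R? p a) ∸ gapEnd c s (val R R? p a ∸ d R R? p a) ∸ 1)
    gap<val : ∀ a → val R R? p a ∸ d R R? p a ℕ.< val R R? p a
    gap<val a = ℕP.∸-monoʳ-< {o = 0} (d≥1 R R? p p-inj p-mono a) (d≤val R R? p p-inj p-mono a)

module ParallelComposition {n₁ n₂ : ℕ} (P : Rel (Fin n₁) 0ℓ) (Q : Rel (Fin n₂) 0ℓ) (P? : Decidable P) (Q? : Decidable Q) where

  open FiniteSums
  open RationalArithmetic
  open BooleanTests
  open LinearExtensions
  open Shuffles
  open GapSums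
  open PredecessorGaps
  open BlockSums
  open Merge P Q P? Q?
  open Reindexing P Q P? Q?
  open import Defs
  open import Data.Nat as ℕ using (ℕ; _∸_; _≤_)
  import Data.Nat.Properties as ℕP
  open import Data.Rational using (ℚ; 1ℚ; _+_; _*_; _-_)
  import Data.Rational.Properties as ℚP
  open import Data.List using (map; allFin; length)
  open import Data.Bool using (true)
  open import Relation.Binary.PropositionalEquality
  open import Data.Rational.Solver
  open +-*-Solver

  -- Each arrangement of the blocks: the number of colour words with n₁ letters c₁.
  β : ℚ
  β = ι (binom n n₁)

  K : ℚ
  K = ι n₁ * (H n - H n₁) + ι n₂ * (H n - H n₂)

  W-c₁≡W-c₂ : (s : Fin n → Colour) → W c₁ n₁ s ≡ W c₂ n₂ s
  W-c₁≡W-c₂ s = cong [_]ℚ (bool-ext _ _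
    (λ e → subst (λ z → (z ℕ.≡ᵇ n₂) ≡ true) (sym (occ₂≡n₂ s (≡ᵇ-sound _ _ e))) (≡ᵇ-refl n₂))
    (λ e → subst (λ z → (z ℕ.≡ᵇ n₁) ≡ true)
             (sym (ℕP.+-cancelʳ-≡ n₂ (occ c₁ s) n₁ (trans (cong (occ c₁ s ℕ.+_) (sym (≡ᵇ-sound _ _ e))) (occ-c₁+c₂ s))))
             (≡ᵇ-refl n₁)))

  -- Hence C(n, n₂) = C(n, n₁), by counting the same words twice.
  binom-n₂ : ι (binom n n₂) ≡ β
  binom-n₂ = trans (sym (∑-W n c₂ n₂)) (trans (∑-cong (allFuns n 2) (λ s → sym (W-c₁≡W-c₂ s))) (∑-W n c₁ n₁))

  qlbTerm-⊕ : ∀ σ → qlbTerm (P ⊕ Q) (⊕-dec P? Q?) σ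
    ≡ ∑ (allFin n₁) (λ a → H (d (P ⊕ Q) (⊕-dec P? Q?) σ (inL a) ∸ 1)) + ∑ (allFin n₂) (λ b → H (d (P ⊕ Q) (⊕-dec P? Q?) σ (inR b) ∸ 1))
  qlbTerm-⊕ σ = trans (cong (λ L → ∑ L term) (allFin-+ n₁ n₂))
    (trans (∑-++ (map inL (allFin n₁)) (map inR (allFin n₂)) term) (cong₂ _+_ (∑-map (allFin n₁) inL term) (∑-map (allFin n₂) inR term)))
    where
    term : Fin n → ℚ
    term i = H (d (P ⊕ Q) (⊕-dec P? Q?) σ i ∸ 1)

  -- The QLB summands of P ⊕ Q over the merges of fixed p and q: by d-inL, d-inR
  -- and ∑-block, each block contributes its own QLB summand plus its share of K.
  ∑-merge-qlbTerm : ∀ p q → isLinExt P P? p ≡ true → isLinExt Q Q? q ≡ true →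
    ∑ (allFuns n 2) (λ s → W c₁ n₁ s * qlbTerm (P ⊕ Q) (⊕-dec P? Q?) (merge p q s)) ≡ β * (qlbTerm P P? p + qlbTerm Q Q? q + K)
  ∑-merge-qlbTerm p q p∈Δ q∈Δ = begin
      ∑ S (λ s → W c₁ n₁ s * qlbTerm (P ⊕ Q) (⊕-dec P? Q?) (merge p q s))
        ≡⟨ ∑-cong S (λ s → W-when c₁ n₁ s _ _ (λ occ₁ → trans (qlbTerm-⊕ (merge p q s)) (cong₂ _+_
             (∑-cong (allFin n₁) (λ a → cong (λ z → H (z ∸ 1)) (Merged.d-inL p q s p∈Δ q∈Δ occ₁ a)))
             (∑-cong (allFin n₂) (λ b → cong (λ z → H (z ∸ 1)) (Merged.d-inR p q s p∈Δ q∈Δ occ₁ b)))))) ⟩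
      ∑ S (λ s → W c₁ n₁ s * (∑ (allFin n₁) (X₁ s) + ∑ (allFin n₂) (X₂ s)))
        ≡⟨ trans (∑-cong S (λ s → ℚP.*-distribˡ-+ (W c₁ n₁ s) _ _)) (∑-+ S _ _) ⟩
      ∑ S (λ s → W c₁ n₁ s * ∑ (allFin n₁) (X₁ s)) + ∑ S (λ s → W c₁ n₁ s * ∑ (allFin n₂) (X₂ s))
        ≡⟨ cong (∑ S (λ s → W c₁ n₁ s * ∑ (allFin n₁) (X₁ s)) +_) (∑-cong S (λ s → cong (_* ∑ (allFin n₂) (X₂ s)) (W-c₁≡W-c₂ s))) ⟩
      ∑ S (λ s → W c₁ n₁ s * ∑ (allFin n₁) (X₁ s)) + ∑ S (λ s → W c₂ n₂ s * ∑ (allFin n₂) (X₂ s))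
        ≡⟨ cong₂ _+_ (∑-block n c₁ P P? p p-inj p-mono)
                     (trans (∑-block n c₂ Q Q? q q-inj q-mono) (cong (_* (qlbTerm Q Q? q + ι n₂ * (H n - H n₂))) binom-n₂)) ⟩
      β * (qlbTerm P P? p + ι n₁ * (H n - H n₁)) + β * (qlbTerm Q Q? q + ι n₂ * (H n - H n₂))
        ≡⟨ solve 5 (λ β x y a b → β :* (x :+ a) :+ β :* (y :+ b) := β :* (x :+ y :+ (a :+ b)))
             refl β (qlbTerm P P? p) (qlbTerm Q Q? q) (ι n₁ * (H n - H n₁)) (ι n₂ * (H n - H n₂)) ⟩
      β * (qlbTerm P P? p + qlbTerm Q Q? q + K) ∎
    where
    open ≡-Reasoning
    S = allFuns n 2
    p-inj  = isLinExt⇒injective P P? p p∈Δ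
    q-inj  = isLinExt⇒injective Q Q? q q∈Δ
    p-mono = isLinExt⇒monotone P P? p p∈Δ
    q-mono = isLinExt⇒monotone Q Q? q q∈Δ
    X₁ : (Fin n → Colour) → Fin n₁ → ℚ
    X₁ s a = H (gapEnd c₁ s (val P P? p a) ∸ gapEnd c₁ s (val P P? p a ∸ d P P? p a) ∸ 1)
    X₂ : (Fin n → Colour) → Fin n₂ → ℚ
    X₂ s b = H (gapEnd c₂ s (val Q Q? q b) ∸ gapEnd c₂ s (val Q Q? q b ∸ d Q Q? q b) ∸ 1)

  length-Δ⊕ : ι (length (Δ (P ⊕ Q) (⊕-dec P? Q?))) ≡ β * (ι (length (Δ P P?)) * ι (length (Δ Q Q?)))
  length-Δ⊕ = begin
      ι (length (Δ (P ⊕ Q) (⊕-dec P? Q?)))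
        ≡⟨ sym (∑-length (Δ (P ⊕ Q) (⊕-dec P? Q?))) ⟩
      ∑ (Δ (P ⊕ Q) (⊕-dec P? Q?)) (λ _ → 1ℚ)
        ≡⟨ ∑-Δ⊕ (λ _ → 1ℚ) (λ _ _ _ → refl) ⟩
      ∑ (Δ P P?) (λ p → ∑ (Δ Q Q?) (λ q → ∑ (allFuns n 2) (λ s → W c₁ n₁ s * 1ℚ)))
        ≡⟨ ∑-cong (Δ P P?) (λ p → ∑-cong (Δ Q Q?) (λ q →
             trans (∑-cong (allFuns n 2) (λ s → ℚP.*-identityʳ (W c₁ n₁ s))) (∑-W n c₁ n₁))) ⟩
      ∑ (Δ P P?) (λ p → ∑ (Δ Q Q?) (λ q → β))
        ≡⟨ trans (∑-cong (Δ P P?) (λ p → ∑-const-list (Δ Q Q?) β)) (∑-const-list (Δ P P?) _) ⟩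
      ι (length (Δ P P?)) * (ι (length (Δ Q Q?)) * β)
        ≡⟨ solve 3 (λ x y b → x :* (y :* b) := b :* (x :* y)) refl (ι (length (Δ P P?))) (ι (length (Δ Q Q?))) β ⟩
      β * (ι (length (Δ P P?)) * ι (length (Δ Q Q?))) ∎
    where open ≡-Reasoning

  Δ⊕-nonempty : 1 ≤ length (Δ P P?) → 1 ≤ length (Δ Q Q?) → 1 ≤ length (Δ (P ⊕ Q) (⊕-dec P? Q?))
  Δ⊕-nonempty P-nonempty Q-nonempty = subst (1 ≤_) (sym length≡)
    (ℕP.*-mono-≤ (binom-pos n n₁ (ℕP.m≤m+n n₁ n₂)) (ℕP.*-mono-≤ P-nonempty Q-nonempty))
    where
    length≡ : length (Δ (P ⊕ Q) (⊕-dec P? Q?)) ≡ binom n n₁ ℕ.* (length (Δ P P?) ℕ.* length (Δ Q Q?))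
    length≡ = ι-injective _ _ (trans length-Δ⊕
      (sym (trans (ι-* (binom n n₁) _) (cong (β *_) (ι-* (length (Δ P P?)) (length (Δ Q Q?)))))))

  total-Δ⊕ : ∑ (Δ (P ⊕ Q) (⊕-dec P? Q?)) (qlbTerm (P ⊕ Q) (⊕-dec P? Q?))
    ≡ β * (ι (length (Δ Q Q?)) * (∑ (Δ P P?) (qlbTerm P P?) + ι (length (Δ P P?)) * K) + ι (length (Δ P P?)) * ∑ (Δ Q Q?) (qlbTerm Q Q?))
  total-Δ⊕ = begin
      ∑ (Δ (P ⊕ Q) (⊕-dec P? Q?)) (qlbTerm (P ⊕ Q) (⊕-dec P? Q?))
        ≡⟨ ∑-Δ⊕ (qlbTerm (P ⊕ Q) (⊕-dec P? Q?)) (qlbTerm-resp (P ⊕ Q) (⊕-dec P? Q?)) ⟩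
      ∑ (Δ P P?) (λ p → ∑ (Δ Q Q?) (λ q → ∑ (allFuns n 2) (λ s → W c₁ n₁ s * qlbTerm (P ⊕ Q) (⊕-dec P? Q?) (merge p q s))))
        ≡⟨ ∑-Δ-cong P P? (λ p p∈Δ → ∑-Δ-cong Q Q? (λ q q∈Δ → ∑-merge-qlbTerm p q p∈Δ q∈Δ)) ⟩
      ∑ (Δ P P?) (λ p → ∑ (Δ Q Q?) (λ q → β * (qlbTerm P P? p + qlbTerm Q Q? q + K)))
        ≡⟨ trans (∑-cong (Δ P P?) (λ p → ∑-*ˡ (Δ Q Q?) β _)) (∑-*ˡ (Δ P P?) β _) ⟩
      β * ∑ (Δ P P?) (λ p → ∑ (Δ Q Q?) (λ q → qlbTerm P P? p + qlbTerm Q Q? q + K))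
        ≡⟨ cong (β *_) (∑∑-separable (Δ P P?) (Δ Q Q?) (qlbTerm P P?) (qlbTerm Q Q?) K) ⟩
      β * (ι (length (Δ Q Q?)) * (∑ (Δ P P?) (qlbTerm P P?) + ι (length (Δ P P?)) * K) + ι (length (Δ P P?)) * ∑ (Δ Q Q?) (qlbTerm Q Q?)) ∎
    where open ≡-Reasoning

  QLB-⊕ : IsPartialOrder _≡_ P → IsPartialOrder _≡_ Q → QLB (P ⊕ Q) (⊕-dec P? Q?) ≡ QLB P P? + QLB Q Q? + K
  QLB-⊕ P-po Q-po = *ι-cancelʳ _ _ (length (Δ (P ⊕ Q) (⊕-dec P? Q?))) ⊕-nonempty (begin
      QLB (P ⊕ Q) (⊕-dec P? Q?) * ι (length (Δ (P ⊕ Q) (⊕-dec P? Q?)))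
        ≡⟨ QLB-total (P ⊕ Q) (⊕-dec P? Q?) ⊕-nonempty ⟩
      ∑ (Δ (P ⊕ Q) (⊕-dec P? Q?)) (qlbTerm (P ⊕ Q) (⊕-dec P? Q?))
        ≡⟨ total-Δ⊕ ⟩
      β * (NQ * (∑ (Δ P P?) (qlbTerm P P?) + NP * K) + NP * ∑ (Δ Q Q?) (qlbTerm Q Q?))
        ≡⟨ cong₂ (λ x y → β * (NQ * (x + NP * K) + NP * y)) (sym (QLB-total P P? P-nonempty)) (sym (QLB-total Q Q? Q-nonempty)) ⟩
      β * (NQ * (QLB P P? * NP + NP * K) + NP * (QLB Q Q? * NQ))
        ≡⟨ solve 6 (λ β x y a b k → β :* (y :* (a :* x :+ x :* k) :+ x :* (b :* y)) := (a :+ b :+ k) :* (β :* (x :* y)))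
             refl β NP NQ (QLB P P?) (QLB Q Q?) K ⟩
      (QLB P P? + QLB Q Q? + K) * (β * (NP * NQ))
        ≡⟨ cong ((QLB P P? + QLB Q Q? + K) *_) (sym length-Δ⊕) ⟩
      (QLB P P? + QLB Q Q? + K) * ι (length (Δ (P ⊕ Q) (⊕-dec P? Q?))) ∎)
    where
    open ≡-Reasoning
    NP = ι (length (Δ P P?))
    NQ = ι (length (Δ Q Q?))
    P-nonempty = Δ-nonempty P P? P-po
    Q-nonempty = Δ-nonempty Q Q? Q-po
    ⊕-nonempty = Δ⊕-nonempty P-nonempty Q-nonempty

  K-nH : ∀ x → x + K ≡ (x + nH n) - nH n₁ - nH n₂
  K-nH x = begin
      x + (ι n₁ * (H n - H n₁) + ι n₂ * (H n - H n₂))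
        ≡⟨ solve 6 (λ x i j h h₁ h₂ → x :+ (i :* (h :- h₁) :+ j :* (h :- h₂)) := x :+ (i :+ j) :* h :- i :* h₁ :- j :* h₂)
             refl x (ι n₁) (ι n₂) (H n) (H n₁) (H n₂) ⟩
      x + (ι n₁ + ι n₂) * H n - ι n₁ * H n₁ - ι n₂ * H n₂
        ≡⟨ cong₂ (λ u v → x + u - v - ι n₂ * H n₂) (trans (cong (_* H n) (sym (ι-+ n₁ n₂))) (sym (nH-ι n))) (sym (nH-ι n₁)) ⟩
      x + nH n - nH n₁ - ι n₂ * H n₂
        ≡⟨ cong (λ v → x + nH n - nH n₁ - v) (sym (nH-ι n₂)) ⟩
      x + nH n - nH n₁ - nH n₂ ∎
    where
    open ≡-Reasoning
    nH-ι : ∀ m → nH m ≡ ι m * H m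
    nH-ι m = cong (_* H m) (sym (ι-/1 m))

open import Defs
open import Data.Nat using (ℕ; _+_)
open import Data.Rational using (_-_) renaming (_+_ to _+ℚ_)
open import Relation.Binary.PropositionalEquality using (trans)

lemma12 : (n₁ n₂ : ℕ) (P : Rel (Fin n₁) 0ℓ) (Q : Rel (Fin n₂) 0ℓ)
          (P-po : IsPartialOrder _≡_ P) (Q-po : IsPartialOrder _≡_ Q)
          (P? : Decidable P) (Q? : Decidable Q) →
          QLB (P ⊕ Q) (⊕-dec P? Q?)
            ≡ ((QLB P P? +ℚ QLB Q Q?) +ℚ nH (n₁ + n₂)) - nH n₁ - nH n₂
lemma12 n₁ n₂ P Q P-po Q-po P? Q? = trans (QLB-⊕ P-po Q-po) (K-nH (QLB P P? +ℚ QLB Q Q?))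
  where open ParallelComposition P Q P? Q?
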